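{- Let $A$ be a linear $\{0,1\}$-matrix. Then $A$ is balanced if and only if $A$ contains no submatrix congruent to $C_3$ and $G_A$ is a diamond-free graph that contains neither an odd hole nor an HOH-free multisun as an induced subgraph.
   Context: A $\{0,1\}$-matrix is linear if it has no $2\times 2$ submatrix with all entries equal to 1. It is balanced if it has no square submatrix of odd order with exactly two 1's in each row and each column. Two matrices are congruent if one is obtained from the other by permuting rows and columns; $C_3$ is the $3\times3$ matrix with $c_{ij}=1$ iff $j\in\{i,i+1\}$ (indices mod 3). The intersection graph $G_A$ of $A$ has the columns of $A$ as vertices, two being adjacent iff they are non-orthogonal (some row has 1 in both). Graphs are finite and simple. The diamond is $K_4$ minus an edge; diamond-free means no induced diamond. A hole is an induced cycle of length at least 4, odd if its length is odd. A multisun is a diamond-free graph of odd order whose maximal cliques of size 2 span a Hamiltonian cycle $C$ (the rim); all other maximal cliques consist of pairwise nonconsecutive vertices of $C$ (inscribed cliques). A sub-multisun is obtained by deleting the edge sets of some, but not all, inscribed cliques. A multisun is HOH-free if it and all its sub-multisuns contain no odd hole. -}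

module Defs where

open import Level using (0ℓ)
open import Data.Nat using (ℕ; zero; suc; _+_; _*_; _≤_)
open import Data.Bool using (Bool; true; false; T)
open import Data.Fin using (Fin; toℕ) renaming (zero to f0; suc to fs)
open import Data.Fin.Subset using (Subset; _∈_; _∉_; ⁅_⁆; _∪_; ∣_∣)
open import Data.Vec using (tabulate)
open import Data.Product using (Σ; ∃; _×_; _,_)
open import Data.Sum using (_⊎_)
open import Relation.Nullary using (¬_)
open import Relation.Binary.PropositionalEquality using (_≡_; _≢_)
open import Function.Definitions using (Injective)
open import Function.Bundles using (_⇔_)

Odd : ℕ → Set
Odd k = ∃ λ t → k ≡ suc (2 * t)

-- {0,1}-matrices: an m × n matrix is a function Fin m → Fin n → Bool,
-- entry 1 ↔ true.

Matrix : ℕ → ℕ → Set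
Matrix m n = Fin m → Fin n → Bool

Linear : ∀ {m n} → Matrix m n → Set
Linear {m} {n} A =
  ¬ (Σ (Fin m) λ i → Σ (Fin m) λ i' → Σ (Fin n) λ j → Σ (Fin n) λ j' →
       i ≢ i' × j ≢ j' ×
       A i j ≡ true × A i j' ≡ true × A i' j ≡ true × A i' j' ≡ true)

-- A square submatrix of order k is given by injective choices of k rows
-- and k columns.  Balanced: no such submatrix of odd order having exactly
-- two 1's in each row and in each column.
Balanced : ∀ {m n} → Matrix m n → Set
Balanced {m} {n} A =
  ¬ (Σ ℕ λ k → Odd k ×
       Σ (Fin k → Fin m) λ r → Σ (Fin k → Fin n) λ c →
         Injective _≡_ _≡_ r × Injective _≡_ _≡_ c ×
         (∀ p → ∣ tabulate (λ q → A (r p) (c q)) ∣ ≡ 2) ×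
         (∀ q → ∣ tabulate (λ p → A (r p) (c q)) ∣ ≡ 2))

-- C₃ : c_ij = 1 iff j ∈ {i, i+1} (mod 3)
C3 : Matrix 3 3
C3 f0 f0 = true
C3 f0 (fs f0) = true
C3 f0 (fs (fs f0)) = false
C3 (fs f0) f0 = false
C3 (fs f0) (fs f0) = true
C3 (fs f0) (fs (fs f0)) = true
C3 (fs (fs f0)) f0 = true
C3 (fs (fs f0)) (fs f0) = false
C3 (fs (fs f0)) (fs (fs f0)) = true

-- A contains a submatrix congruent to C₃ (row/column permutations are
-- absorbed by the arbitrary injective row/column selections).
ContainsC3 : ∀ {m n} → Matrix m n → Set
ContainsC3 {m} {n} A =
  Σ (Fin 3 → Fin m) λ r → Σ (Fin 3 → Fin n) λ c →
    Injective _≡_ _≡_ r × Injective _≡_ _≡_ c ×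
    (∀ p q → A (r p) (c q) ≡ C3 p q)

Graph : ℕ → Set₁
Graph k = Fin k → Fin k → Set

IsSimple : ∀ {k} → Graph k → Set
IsSimple {k} G = (∀ u v → G u v → G v u) × (∀ u → ¬ G u u)

IntersectionGraph : ∀ {m n} → Matrix m n → Graph n
IntersectionGraph {m} A j j' = j ≢ j' × Σ (Fin m) λ i → A i j ≡ true × A i j' ≡ true

InducedSub : ∀ {k n} → Graph k → Graph n → Set
InducedSub {k} {n} H G =
  Σ (Fin k → Fin n) λ f → Injective _≡_ _≡_ f × (∀ a b → G (f a) (f b) ⇔ H a b)

-- the diamond K₄ minus the edge {0,3}
diamondB : Fin 4 → Fin 4 → Bool
diamondB f0 f0 = false
diamondB f0 (fs f0) = true
diamondB f0 (fs (fs f0)) = true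
diamondB f0 (fs (fs (fs f0))) = false
diamondB (fs f0) f0 = true
diamondB (fs f0) (fs f0) = false
diamondB (fs f0) (fs (fs f0)) = true
diamondB (fs f0) (fs (fs (fs f0))) = true
diamondB (fs (fs f0)) f0 = true
diamondB (fs (fs f0)) (fs f0) = true
diamondB (fs (fs f0)) (fs (fs f0)) = false
diamondB (fs (fs f0)) (fs (fs (fs f0))) = true
diamondB (fs (fs (fs f0))) f0 = false
diamondB (fs (fs (fs f0))) (fs f0) = true
diamondB (fs (fs (fs f0))) (fs (fs f0)) = true
diamondB (fs (fs (fs f0))) (fs (fs (fs f0))) = false

Diamond : Graph 4
Diamond a b = T (diamondB a b)

DiamondFree : ∀ {n} → Graph n → Set
DiamondFree G = ¬ InducedSub Diamond G

-- the cycle on Fin k: a ~ b iff b = a ± 1 (mod k)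
CycleGraph : (k : ℕ) → Graph k
CycleGraph k a b =
  suc (toℕ a) ≡ toℕ b ⊎ suc (toℕ b) ≡ toℕ a ⊎
  (toℕ a ≡ 0 × suc (toℕ b) ≡ k) ⊎ (toℕ b ≡ 0 × suc (toℕ a) ≡ k)

HasOddHole : ∀ {n} → Graph n → Set
HasOddHole G = Σ ℕ λ k → 4 ≤ k × Odd k × InducedSub (CycleGraph k) G

IsClique : ∀ {k} → Graph k → Subset k → Set
IsClique G Q = ∀ u v → u ∈ Q → v ∈ Q → u ≢ v → G u v

IsMaxClique : ∀ {k} → Graph k → Subset k → Set
IsMaxClique G Q = IsClique G Q × (∀ w → w ∉ Q → ¬ (∀ u → u ∈ Q → G u w))

Inscribed : ∀ {k} → Graph k → Subset k → Set
Inscribed G Q = IsMaxClique G Q × ¬ (∣ Q ∣ ≡ 2)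

-- consecutiveness on the Hamiltonian cycle σ(0), σ(1), …, σ(k-1), σ(0)
RimAdj : ∀ {k} → (Fin k → Fin k) → Fin k → Fin k → Set
RimAdj {k} σ u v = Σ (Fin k) λ i → Σ (Fin k) λ j → CycleGraph k i j × σ i ≡ u × σ j ≡ v

IsMultisun : ∀ {k} → Graph k → Set
IsMultisun {k} G =
  IsSimple G × Odd k × 3 ≤ k × DiamondFree G ×
  Σ (Fin k → Fin k) λ σ → Injective _≡_ _≡_ σ ×
    (∀ Q → (IsMaxClique G Q × ∣ Q ∣ ≡ 2) ⇔
           (Σ (Fin k) λ u → Σ (Fin k) λ v → RimAdj σ u v × Q ≡ ⁅ u ⁆ ∪ ⁅ v ⁆)) ×
    (∀ Q → Inscribed G Q → ∀ u v → u ∈ Q → v ∈ Q → ¬ RimAdj σ u v)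

ValidDeletion : ∀ {k} → Graph k → (Subset k → Bool) → Set
ValidDeletion {k} G D =
  (∀ Q → D Q ≡ true → Inscribed G Q) × Σ (Subset k) λ Q → Inscribed G Q × D Q ≡ false

DeleteCliques : ∀ {k} → Graph k → (Subset k → Bool) → Graph k
DeleteCliques {k} G D u v = G u v × ¬ (Σ (Subset k) λ Q → D Q ≡ true × u ∈ Q × v ∈ Q)

-- HOH-free multisun: it and all its sub-multisuns have no odd hole
IsHOHFreeMultisun : ∀ {k} → Graph k → Set
IsHOHFreeMultisun {k} G =
  IsMultisun G × ¬ HasOddHole G ×
  (∀ D → ValidDeletion G D → ¬ HasOddHole (DeleteCliques G D))

ContainsHOHFreeMultisun : ∀ {n} → Graph n → Set₁
ContainsHOHFreeMultisun G =
  Σ ℕ λ k → Σ (Graph k) λ H → IsHOHFreeMultisun H × InducedSub H G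

-- An odd square submatrix with exactly two 1's in each row and column contains an odd cycle
-- of columns c₀, …, c_L, each two consecutive ones lying in a row that meets no other column
-- of the cycle: follow the 1's from column to column, and discard even cycles, which keeps
-- the number of remaining columns odd. Conversely a C₃, an odd hole or the rim of a multisun
-- is such an odd cycle, and in a linear matrix a diamond forces a C₃.
--
-- For sufficiency take a shortest odd cycle. A row through exactly two non-consecutive
-- columns of it would cut it into two shorter cycles, one of them odd; and without C₃ a row
-- through an edge contains every common neighbour of its ends. Hence the columns of the
-- cycle induce a multisun with the cycle as rim. An odd hole of a sub-multisun is either
-- shorter, and then again a shorter odd cycle, or passes through all vertices, which a
-- vertex of a kept inscribed clique prevents, having three neighbours there.
module Submission where

open import Defs
open import Data.Bool using (Bool; true; false; not; _xor_; _∧_; _∨_)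
open import Data.Bool.Properties using (∧-identityʳ; xor-identityʳ; xor-∧-commutativeRing; ¬-not; not-¬; not-involutive; not-distribˡ-xor; xor-same)
open import Algebra.Bundles using (CommutativeRing)
open import Algebra.Properties.CommutativeSemigroup (CommutativeRing.+-commutativeSemigroup xor-∧-commutativeRing)
  using () renaming (interchange to xor-interchange)
open import Data.Empty using (⊥; ⊥-elim)
open import Data.Fin using (Fin; toℕ; fromℕ<; _≟_; punchOut) renaming (zero to f0; suc to fs)
open import Data.Fin.Properties using (pigeonhole; toℕ-injective; toℕ-fromℕ<; toℕ<n; any?; injective⇒≤; punchOut-injective) renaming (suc-injective to fs-injective)
open import Data.Fin.Subset using (Subset; _∈_; _∉_; ⁅_⁆; _∪_; ∣_∣; inside; outside)
open import Data.Fin.Subset.Properties using (p⊂q⇒∣p∣<∣q∣; ⊆-antisym; _∈?_; x∈p∪q⁻; x∈p∪q⁺; x∈⁅x⁆; x∈⁅y⁆⇒x≡y)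
open import Data.Nat using (ℕ; zero; suc; _+_; _*_; _∸_; _≤_; _<_; z≤n; s≤s; NonZero)
open import Data.Nat.DivMod
  using (_%_; _/_; m%n<n; %-distribˡ-+; m%n%n≡m%n; m<n⇒m%n≡m; [m+n]%n≡m%n; m≡m%n+[m/n]*n; m*n%n≡0; n%n≡0)
open import Data.Nat.Induction using (<-rec)
open import Data.Nat.Properties
  using (suc-injective; ≤-refl; n≮0; n<1+n; <-trans; <-cmp; ≤-pred; ≤∧≢⇒<; +-cancelʳ-≤; +-monoʳ-≤; n≤1+n; +-identityʳ; +-suc; +-comm; +-assoc; +-cancelˡ-≡; m+[n∸m]≡n; m∸n+n≡m; m∸n≤m; m∸n≡0⇒m≤n;
         <-irrefl; <⇒≤; ≤-<-trans; ≤-trans; ≤-total; ≤-antisym; m≤n⇒m<n∨m≡n)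
open import Data.Vec.Base using (tabulate; []; _∷_; here; there)
open import Data.Vec.Properties using (tabulate-cong; []=⇒lookup; lookup⇒[]=; lookup∘tabulate)
open import Data.Product using (∃; _×_; _,_; proj₁; proj₂; map₁)
import Data.Product as Product
open import Data.Sum using (_⊎_; inj₁; inj₂)
import Data.Sum as Sum
open import Function.Base using (_∘_; id)
open import Function.Bundles using (_⇔_; Equivalence; mk⇔)
open import Function.Definitions using (Injective)
open import Relation.Nullary using (¬_; yes; no; does)
open import Relation.Nullary.Decidable using (_×-dec_; ¬?)
open import Relation.Binary.Definitions using (tri<; tri≈; tri>)
open import Relation.Binary.PropositionalEquality hiding (J)

private variable
  k L : ℕ

next : Fin (suc L) → Fin (suc L)
next {L} i = fromℕ< (m%n<n (suc (toℕ i)) (suc L))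

next^ : ℕ → Fin (suc L) → Fin (suc L)
next^ zero    i = i
next^ (suc e) i = next (next^ e i)

prev : Fin (suc L) → Fin (suc L)
prev {L} = next^ L

toℕ-next : (i : Fin (suc L)) → toℕ (next i) ≡ suc (toℕ i) % suc L
toℕ-next {L} i = toℕ-fromℕ< (m%n<n (suc (toℕ i)) (suc L))

suc-%-idem : ∀ x d .{{_ : NonZero d}} → suc (x % d) % d ≡ suc x % d
suc-%-idem x d = begin
  (1 + x % d) % d          ≡⟨ %-distribˡ-+ 1 (x % d) d ⟩
  (1 % d + x % d % d) % d  ≡⟨ cong (λ z → (1 % d + z) % d) (m%n%n≡m%n x d) ⟩
  (1 % d + x % d) % d      ≡⟨ %-distribˡ-+ 1 x d ⟨
  (1 + x) % d              ∎
  where open ≡-Reasoning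

toℕ-next^ : ∀ e (i : Fin (suc L)) → toℕ (next^ e i) ≡ (toℕ i + e) % suc L
toℕ-next^ {L} zero i = begin
  toℕ i               ≡⟨ m<n⇒m%n≡m (toℕ<n i) ⟨
  toℕ i % suc L       ≡⟨ cong (_% suc L) (+-identityʳ (toℕ i)) ⟨
  (toℕ i + 0) % suc L ∎
  where open ≡-Reasoning
toℕ-next^ {L} (suc e) i = begin
  toℕ (next (next^ e i))              ≡⟨ toℕ-next (next^ e i) ⟩
  suc (toℕ (next^ e i)) % suc L       ≡⟨ cong (λ z → suc z % suc L) (toℕ-next^ e i) ⟩
  suc ((toℕ i + e) % suc L) % suc L   ≡⟨ suc-%-idem (toℕ i + e) (suc L) ⟩
  suc (toℕ i + e) % suc L             ≡⟨ cong (_% suc L) (+-suc (toℕ i) e) ⟨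
  (toℕ i + suc e) % suc L             ∎
  where open ≡-Reasoning

next^-+ : ∀ s t (i : Fin (suc L)) → next^ (s + t) i ≡ next^ s (next^ t i)
next^-+ zero    t i = refl
next^-+ (suc s) t i = cong next (next^-+ s t i)

next^-period : (i : Fin (suc L)) → next^ (suc L) i ≡ i
next^-period {L} i = toℕ-injective (begin
  toℕ (next^ (suc L) i)       ≡⟨ toℕ-next^ (suc L) i ⟩
  (toℕ i + suc L) % suc L     ≡⟨ [m+n]%n≡m%n (toℕ i) (suc L) ⟩
  toℕ i % suc L               ≡⟨ m<n⇒m%n≡m (toℕ<n i) ⟩
  toℕ i                       ∎)
  where open ≡-Reasoning

next^-fixed⇒%≡0 : ∀ e (i : Fin (suc L)) → next^ e i ≡ i → e % suc L ≡ 0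
next^-fixed⇒%≡0 {L} e i fixed = trans (cong (_% suc L) e≡qn) (m*n%n≡0 q (suc L))
  where
  q = (toℕ i + e) / suc L
  e≡qn : e ≡ q * suc L
  e≡qn = +-cancelˡ-≡ (toℕ i) e (q * suc L) (begin
    toℕ i + e                                ≡⟨ m≡m%n+[m/n]*n (toℕ i + e) (suc L) ⟩
    (toℕ i + e) % suc L + q * suc L          ≡⟨ cong (_+ q * suc L) (trans (sym (toℕ-next^ e i)) (cong toℕ fixed)) ⟩
    toℕ i + q * suc L                        ∎)
    where open ≡-Reasoning

next^-≢ : ∀ e (i : Fin (suc L)) → 0 < e → e ≤ L → next^ e i ≢ i
next^-≢ e i 0<e e≤L fixed = <-irrefl (sym e≡0) 0<e
  where e≡0 = trans (sym (m<n⇒m%n≡m (s≤s e≤L))) (next^-fixed⇒%≡0 e i fixed)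

next-≢ : 1 ≤ L → (i : Fin (suc L)) → next i ≢ i
next-≢ 1≤L i = next^-≢ 1 i (s≤s z≤n) 1≤L

next²-≢ : 2 ≤ L → (i : Fin (suc L)) → next (next i) ≢ i
next²-≢ 2≤L i = next^-≢ 2 i (s≤s z≤n) 2≤L

next-injective : Injective _≡_ _≡_ (next {L})
next-injective {L} {i} {j} eq = begin
  i                     ≡⟨ next^-period i ⟨
  next^ (suc L) i       ≡⟨ cong (λ z → next^ z i) (+-comm 1 L) ⟩
  next^ (L + 1) i       ≡⟨ next^-+ L 1 i ⟩
  next^ L (next i)      ≡⟨ cong (next^ L) eq ⟩
  next^ L (next j)      ≡⟨ next^-+ L 1 j ⟨
  next^ (L + 1) j       ≡⟨ cong (λ z → next^ z j) (+-comm 1 L) ⟨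
  next^ (suc L) j       ≡⟨ next^-period j ⟩
  j                     ∎
  where open ≡-Reasoning

next-prev : (i : Fin (suc L)) → next (prev i) ≡ i
next-prev = next^-period

prev-next : (i : Fin (suc L)) → prev (next i) ≡ i
prev-next i = next-injective (next-prev (next i))

next^-reach : (i j : Fin (suc L)) → ∃ λ d → d < suc L × next^ d i ≡ j
next^-reach {L} i j = d , m%n<n (b + (suc L ∸ a)) (suc L) , toℕ-injective (begin
  toℕ (next^ d i)                                   ≡⟨ toℕ-next^ d i ⟩
  (a + d) % suc L                                   ≡⟨ %-distribˡ-+ a d (suc L) ⟩
  (a % suc L + d % suc L) % suc L                   ≡⟨ cong (λ z → (a % suc L + z) % suc L) (m%n%n≡m%n (b + (suc L ∸ a)) (suc L)) ⟩
  (a % suc L + (b + (suc L ∸ a)) % suc L) % suc L   ≡⟨ %-distribˡ-+ a (b + (suc L ∸ a)) (suc L) ⟨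
  (a + (b + (suc L ∸ a))) % suc L                   ≡⟨ cong (_% suc L) shuffle ⟩
  (b + suc L) % suc L                               ≡⟨ [m+n]%n≡m%n b (suc L) ⟩
  b % suc L                                         ≡⟨ m<n⇒m%n≡m (toℕ<n j) ⟩
  b                                                 ∎)
  where
  open ≡-Reasoning
  a = toℕ i
  b = toℕ j
  d = (b + (suc L ∸ a)) % suc L
  shuffle : a + (b + (suc L ∸ a)) ≡ b + suc L
  shuffle = begin
    a + (b + (suc L ∸ a))   ≡⟨ +-assoc a b (suc L ∸ a) ⟨
    a + b + (suc L ∸ a)     ≡⟨ cong (_+ (suc L ∸ a)) (+-comm a b) ⟩
    b + a + (suc L ∸ a)     ≡⟨ +-assoc b a (suc L ∸ a) ⟩
    b + (a + (suc L ∸ a))   ≡⟨ cong (b +_) (m+[n∸m]≡n (<⇒≤ (toℕ<n i))) ⟩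
    b + suc L               ∎

next^-gap : ∀ (i : Fin (suc L)) s t → s ≤ t → t < suc L → next^ t i ≡ next^ s i → t ≡ s
next^-gap i s t s≤t t<L eq = ≤-antisym (m∸n≡0⇒m≤n gap≡0) s≤t
  where
  gap≡0 : t ∸ s ≡ 0
  gap≡0 = trans (sym (m<n⇒m%n≡m (≤-<-trans (m∸n≤m t s) t<L)))
    (next^-fixed⇒%≡0 (t ∸ s) (next^ s i)
      (trans (sym (next^-+ (t ∸ s) s i)) (trans (cong (λ z → next^ z i) (m∸n+n≡m s≤t)) eq)))

next^-injective-below : ∀ (i : Fin (suc L)) s t → s < suc L → t < suc L → next^ s i ≡ next^ t i → s ≡ t
next^-injective-below i s t s<L t<L eq with ≤-total s t
... | inj₁ s≤t = sym (next^-gap i s t s≤t t<L (sym eq))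
... | inj₂ t≤s = next^-gap i t s t≤s s<L eq

toℕ-next-wrap : (i : Fin (suc L)) → suc (toℕ i) ≡ suc L → toℕ (next i) ≡ 0
toℕ-next-wrap {L} i i+1≡L = trans (toℕ-next i) (trans (cong (_% suc L) i+1≡L) (n%n≡0 (suc L)))

toℕ-next-cases : (i : Fin (suc L)) →
  suc (toℕ i) ≡ toℕ (next i) ⊎ (toℕ (next i) ≡ 0 × suc (toℕ i) ≡ suc L)
toℕ-next-cases i with m≤n⇒m<n∨m≡n (toℕ<n i)
... | inj₁ i+1<L = inj₁ (sym (trans (toℕ-next i) (m<n⇒m%n≡m i+1<L)))
... | inj₂ i+1≡L = inj₂ (toℕ-next-wrap i i+1≡L , i+1≡L)

next-of-successor : (i j : Fin (suc L)) → suc (toℕ i) ≡ toℕ j → j ≡ next i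
next-of-successor {L} i j e =
  toℕ-injective (trans (sym e) (sym (trans (toℕ-next i) (m<n⇒m%n≡m (subst (_< suc L) (sym e) (toℕ<n j))))))

next-of-last : (i j : Fin (suc L)) → toℕ j ≡ 0 → suc (toℕ i) ≡ suc L → j ≡ next i
next-of-last i j j≡0 i+1≡L = toℕ-injective (trans j≡0 (sym (toℕ-next-wrap i i+1≡L)))

CycleGraph⇒next : (i j : Fin (suc L)) → CycleGraph (suc L) i j → j ≡ next i ⊎ i ≡ next j
CycleGraph⇒next i j (inj₁ e)                         = inj₁ (next-of-successor i j e)
CycleGraph⇒next i j (inj₂ (inj₁ e))                  = inj₂ (next-of-successor j i e)
CycleGraph⇒next i j (inj₂ (inj₂ (inj₁ (i≡0 , e))))   = inj₂ (next-of-last j i i≡0 e)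
CycleGraph⇒next i j (inj₂ (inj₂ (inj₂ (j≡0 , e))))   = inj₁ (next-of-last i j j≡0 e)

CycleGraph-next : (i : Fin (suc L)) → CycleGraph (suc L) i (next i)
CycleGraph-next i with toℕ-next-cases i
... | inj₁ e = inj₁ e
... | inj₂ e = inj₂ (inj₂ (inj₂ e))

CycleGraph-sym : ∀ {k} (i j : Fin k) → CycleGraph k i j → CycleGraph k j i
CycleGraph-sym i j (inj₁ e)                 = inj₂ (inj₁ e)
CycleGraph-sym i j (inj₂ (inj₁ e))          = inj₁ e
CycleGraph-sym i j (inj₂ (inj₂ (inj₁ e)))   = inj₂ (inj₂ (inj₂ e))
CycleGraph-sym i j (inj₂ (inj₂ (inj₂ e)))   = inj₂ (inj₂ (inj₁ e))

next⇒CycleGraph : (i j : Fin (suc L)) → j ≡ next i ⊎ i ≡ next j → CycleGraph (suc L) i j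
next⇒CycleGraph i j (inj₁ refl) = CycleGraph-next i
next⇒CycleGraph i j (inj₂ refl) = CycleGraph-sym j (next j) (CycleGraph-next j)

CycleGraph-neighbours : (i j : Fin (suc L)) → CycleGraph (suc L) i j → j ≡ next i ⊎ j ≡ prev i
CycleGraph-neighbours i j c with CycleGraph⇒next i j c
... | inj₁ e = inj₁ e
... | inj₂ e = inj₂ (trans (sym (prev-next j)) (cong prev (sym e)))

CycleGraph-triangle-free : (i s : Fin (suc L)) → 3 ≤ L →
  CycleGraph (suc L) s i → CycleGraph (suc L) s (next i) → ⊥
CycleGraph-triangle-free i s 3≤L s~i s~i+1 with CycleGraph⇒next s i s~i | CycleGraph⇒next s (next i) s~i+1
... | inj₁ e₁ | inj₁ e₂ = next-≢ (≤-trans (s≤s z≤n) 3≤L) i (trans e₂ (sym e₁))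
... | inj₁ e₁ | inj₂ e₂ = next^-≢ 3 i (s≤s z≤n) 3≤L (sym (trans e₁ (cong next e₂)))
... | inj₂ e₁ | inj₁ e₂ = next-≢ (≤-trans (s≤s z≤n) 3≤L) s (trans (sym e₂) (sym e₁))
... | inj₂ e₁ | inj₂ e₂ = next-≢ (≤-trans (s≤s z≤n) 3≤L) (next i) (trans (sym e₂) e₁)

complement-bounds : ∀ d → 2 ≤ d → d < L → 2 ≤ suc L ∸ d × suc L ∸ d < L
complement-bounds {L} d 2≤d d<L =
  +-cancelʳ-≤ d 2 e (subst (2 + d ≤_) (sym e+d≡L+1) (s≤s d<L)) ,
  ≤-pred (subst (suc (suc e) ≤_) e+d≡L+1 (subst (_≤ e + d) (+-comm e 2) (+-monoʳ-≤ e 2≤d)))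
  where
  e = suc L ∸ d
  e+d≡L+1 : e + d ≡ suc L
  e+d≡L+1 = m∸n+n≡m (<⇒≤ (≤-trans d<L (n≤1+n L)))

∈-tabulate⁻ : (g : Fin k → Bool) {x : Fin k} → x ∈ tabulate g → g x ≡ true
∈-tabulate⁻ g {x} x∈ = trans (sym (lookup∘tabulate g x)) ([]=⇒lookup x∈)

∈-tabulate⁺ : (g : Fin k → Bool) {x : Fin k} → g x ≡ true → x ∈ tabulate g
∈-tabulate⁺ g {x} gx = lookup⇒[]= x (tabulate g) (trans (lookup∘tabulate g x) gx)

IsDoubleton : Subset k → Fin k → Fin k → Set
IsDoubleton p u v = u ≢ v × u ∈ p × v ∈ p × (∀ x → x ∈ p → x ≡ u ⊎ x ≡ v)

∉⇒∣p∣≡0 : (p : Subset k) → (∀ x → x ∉ p) → ∣ p ∣ ≡ 0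
∉⇒∣p∣≡0 []            _    = refl
∉⇒∣p∣≡0 (inside ∷ p)  none = ⊥-elim (none f0 here)
∉⇒∣p∣≡0 (outside ∷ p) none = ∉⇒∣p∣≡0 p (λ x x∈p → none (fs x) (there x∈p))

∣p∣≡0⇒∉ : (p : Subset k) → ∣ p ∣ ≡ 0 → ∀ x → x ∉ p
∣p∣≡0⇒∉ (inside ∷ p)  ()
∣p∣≡0⇒∉ (outside ∷ p) e (fs x) (there x∈p) = ∣p∣≡0⇒∉ p e x x∈p

singleton⇒∣p∣≡1 : (p : Subset k) (u : Fin k) → u ∈ p → (∀ x → x ∈ p → x ≡ u) → ∣ p ∣ ≡ 1
singleton⇒∣p∣≡1 (inside ∷ p) f0 _ only =
  cong suc (∉⇒∣p∣≡0 p (λ x x∈p → fs≢f0 (only (fs x) (there x∈p))))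
  where
  fs≢f0 : ∀ {x : Fin k} → fs x ≢ f0
  fs≢f0 ()
singleton⇒∣p∣≡1 (inside ∷ p) (fs u) _ only with only f0 here
... | ()
singleton⇒∣p∣≡1 (outside ∷ p) (fs u) (there u∈p) only =
  singleton⇒∣p∣≡1 p u u∈p (λ x x∈p → fs-injective (only (fs x) (there x∈p)))

∣p∣≡1⇒singleton : (p : Subset k) → ∣ p ∣ ≡ 1 → ∃ λ u → u ∈ p × (∀ x → x ∈ p → x ≡ u)
∣p∣≡1⇒singleton (inside ∷ p) e = f0 , here , only
  where
  only : ∀ x → x ∈ inside ∷ p → x ≡ f0
  only f0     _           = refl
  only (fs x) (there x∈p) = ⊥-elim (∣p∣≡0⇒∉ p (suc-injective e) x x∈p)
∣p∣≡1⇒singleton (outside ∷ p) e with ∣p∣≡1⇒singleton p e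
... | u , u∈p , only = fs u , there u∈p , λ { (fs x) (there x∈p) → cong fs (only x x∈p) }

doubleton⇒∣p∣≡2 : (p : Subset k) (u v : Fin k) → IsDoubleton p u v → ∣ p ∣ ≡ 2
doubleton⇒∣p∣≡2 (inside ∷ p) f0 f0 (u≢v , _) = ⊥-elim (u≢v refl)
doubleton⇒∣p∣≡2 (inside ∷ p) f0 (fs v) (_ , _ , there v∈p , only) =
  cong suc (singleton⇒∣p∣≡1 p v v∈p (λ x x∈p → other (only (fs x) (there x∈p))))
  where
  other : ∀ {x} → fs x ≡ f0 ⊎ fs x ≡ fs v → x ≡ v
  other (inj₂ e) = fs-injective e
doubleton⇒∣p∣≡2 (inside ∷ p) (fs u) f0 (_ , there u∈p , _ , only) =
  cong suc (singleton⇒∣p∣≡1 p u u∈p (λ x x∈p → other (only (fs x) (there x∈p))))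
  where
  other : ∀ {x} → fs x ≡ fs u ⊎ fs x ≡ f0 → x ≡ u
  other (inj₁ e) = fs-injective e
doubleton⇒∣p∣≡2 (inside ∷ p) (fs u) (fs v) (_ , _ , _ , only) with only f0 here
... | inj₁ ()
... | inj₂ ()
doubleton⇒∣p∣≡2 (outside ∷ p) (fs u) (fs v) (u≢v , there u∈p , there v∈p , only) =
  doubleton⇒∣p∣≡2 p u v (u≢v ∘ cong fs , u∈p , v∈p , λ x x∈p → Sum.map fs-injective fs-injective (only (fs x) (there x∈p)))

∣p∣≡2⇒doubleton : (p : Subset k) → ∣ p ∣ ≡ 2 → ∃ λ u → ∃ λ v → IsDoubleton p u v
∣p∣≡2⇒doubleton (inside ∷ p) e with ∣p∣≡1⇒singleton p (suc-injective e)
... | v , v∈p , only = f0 , fs v , (λ ()) , here , there v∈p , λ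
  { f0 _ → inj₁ refl
  ; (fs x) (there x∈p) → inj₂ (cong fs (only x x∈p)) }
∣p∣≡2⇒doubleton (outside ∷ p) e with ∣p∣≡2⇒doubleton p e
... | u , v , u≢v , u∈p , v∈p , only = fs u , fs v , u≢v ∘ fs-injective , there u∈p , there v∈p , λ
  { (fs x) (there x∈p) → Sum.map (cong fs) (cong fs) (only x x∈p) }

pair : Fin k → Fin k → Subset k
pair u v = ⁅ u ⁆ ∪ ⁅ v ⁆

∈-pair⁻ : {u v x : Fin k} → x ∈ pair u v → x ≡ u ⊎ x ≡ v
∈-pair⁻ {u = u} {v} x∈ = Sum.map (x∈⁅y⁆⇒x≡y u) (x∈⁅y⁆⇒x≡y v) (x∈p∪q⁻ ⁅ u ⁆ ⁅ v ⁆ x∈)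

left∈pair : (u v : Fin k) → u ∈ pair u v
left∈pair u v = x∈p∪q⁺ (inj₁ (x∈⁅x⁆ u))

right∈pair : (u v : Fin k) → v ∈ pair u v
right∈pair u v = x∈p∪q⁺ {p = ⁅ u ⁆} (inj₂ (x∈⁅x⁆ v))

∣pair∣≡2 : (u v : Fin k) → u ≢ v → ∣ pair u v ∣ ≡ 2
∣pair∣≡2 u v u≢v = doubleton⇒∣p∣≡2 (pair u v) u v (u≢v , left∈pair u v , right∈pair u v , λ x → ∈-pair⁻)

injective⇒surjective : ∀ {N} (g : Fin N → Fin N) → Injective _≡_ _≡_ g → ∀ y → ∃ λ x → g x ≡ y
injective⇒surjective {suc N} g g-inj y with any? (λ x → g x ≟ y)
... | yes hit = hit
... | no miss = ⊥-elim (<-irrefl refl (injective⇒≤ {f = g′} g′-inj))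
  where
  g≢y : ∀ x → y ≢ g x
  g≢y x e = miss (x , sym e)
  g′ : Fin (suc N) → Fin N
  g′ x = punchOut (g≢y x)
  g′-inj : Injective _≡_ _≡_ g′
  g′-inj {a} {b} = g-inj ∘ punchOut-injective (g≢y a) (g≢y b)

three-in-two : ∀ {a} {X : Set a} {x y j₁ j₂ j₃ : X} →
  j₁ ≡ x ⊎ j₁ ≡ y → j₂ ≡ x ⊎ j₂ ≡ y → j₃ ≡ x ⊎ j₃ ≡ y → j₁ ≡ j₂ ⊎ j₁ ≡ j₃ ⊎ j₂ ≡ j₃
three-in-two (inj₁ p) (inj₁ q) _        = inj₁ (trans p (sym q))
three-in-two (inj₂ p) (inj₂ q) _        = inj₁ (trans p (sym q))
three-in-two (inj₁ p) (inj₂ q) (inj₁ r) = inj₂ (inj₁ (trans p (sym r)))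
three-in-two (inj₁ p) (inj₂ q) (inj₂ r) = inj₂ (inj₂ (trans q (sym r)))
three-in-two (inj₂ p) (inj₁ q) (inj₁ r) = inj₂ (inj₂ (trans q (sym r)))
three-in-two (inj₂ p) (inj₁ q) (inj₂ r) = inj₂ (inj₁ (trans p (sym r)))

module _ (g : Fin k → Bool) (∣g∣≡2 : ∣ tabulate g ∣ ≡ 2) where

  some-true : ∃ λ a → g a ≡ true
  some-true with ∣p∣≡2⇒doubleton (tabulate g) ∣g∣≡2
  ... | a , _ , _ , a∈ , _ = a , ∈-tabulate⁻ g a∈

  other : Fin k → Fin k
  other q with ∣p∣≡2⇒doubleton (tabulate g) ∣g∣≡2
  ... | a , b , _ with q ≟ a
  ...   | yes _ = b
  ...   | no  _ = a

  other-spec : ∀ q → g q ≡ true →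
    g (other q) ≡ true × other q ≢ q × (∀ q′ → g q′ ≡ true → q′ ≡ q ⊎ q′ ≡ other q)
  other-spec q gq with ∣p∣≡2⇒doubleton (tabulate g) ∣g∣≡2
  ... | a , b , a≢b , a∈ , b∈ , only with q ≟ a
  ...   | yes refl = ∈-tabulate⁻ g b∈ , a≢b ∘ sym , λ q′ → only q′ ∘ ∈-tabulate⁺ g
  ...   | no  q≢a with only q (∈-tabulate⁺ g gq)
  ...     | inj₁ q≡a  = ⊥-elim (q≢a q≡a)
  ...     | inj₂ refl = ∈-tabulate⁻ g a∈ , a≢b , λ q′ → Sum.swap ∘ only q′ ∘ ∈-tabulate⁺ g

oddᵇ : ℕ → Bool
oddᵇ zero    = false
oddᵇ (suc n) = not (oddᵇ n)

oddᵇ-+ : ∀ a b → oddᵇ (a + b) ≡ oddᵇ a xor oddᵇ b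
oddᵇ-+ zero    b = refl
oddᵇ-+ (suc a) b = trans (cong not (oddᵇ-+ a b)) (not-distribˡ-xor (oddᵇ a) (oddᵇ b))

Odd⇒oddᵇ : ∀ {n} → Odd n → oddᵇ n ≡ true
Odd⇒oddᵇ (t , refl) = cong not (begin
  oddᵇ (t + (t + 0))          ≡⟨ oddᵇ-+ t (t + 0) ⟩
  oddᵇ t xor oddᵇ (t + 0)     ≡⟨ cong (λ z → oddᵇ t xor oddᵇ z) (+-identityʳ t) ⟩
  oddᵇ t xor oddᵇ t           ≡⟨ xor-same (oddᵇ t) ⟩
  false                       ∎)
  where open ≡-Reasoning

oddᵇ⇒Odd : ∀ n → oddᵇ n ≡ true → Odd n
oddᵇ⇒Odd (suc zero)    _ = 0 , refl
oddᵇ⇒Odd (suc (suc n)) e with oddᵇ⇒Odd n (trans (sym (not-involutive (oddᵇ n))) e)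
... | t , refl = suc t , cong (suc ∘ suc) (sym (+-suc t (t + 0)))

Odd-+⇒Odd-suc : ∀ d e → Odd (d + e) → Odd (suc d) ⊎ Odd (suc e)
Odd-+⇒Odd-suc d e odd with oddᵇ (suc d) in d+1 | oddᵇ (suc e) in e+1
... | true  | _    = inj₁ (oddᵇ⇒Odd (suc d) d+1)
... | false | true = inj₂ (oddᵇ⇒Odd (suc e) e+1)
... | false | false = ⊥-elim (not-¬ (Odd⇒oddᵇ odd) (begin
  oddᵇ (d + e)                     ≡⟨ oddᵇ-+ d e ⟩
  oddᵇ d xor oddᵇ e                ≡⟨ cong₂ _xor_ (even-suc⇒odd d d+1) (even-suc⇒odd e e+1) ⟩
  true xor true                    ≡⟨⟩
  false                            ∎))
  where
  open ≡-Reasoning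
  even-suc⇒odd : ∀ x → not (oddᵇ x) ≡ false → oddᵇ x ≡ true
  even-suc⇒odd x e = trans (sym (not-involutive (oddᵇ x))) (cong not e)

oddSizeᵇ : (Fin k → Bool) → Bool
oddSizeᵇ {zero}  f = false
oddSizeᵇ {suc k} f = f f0 xor oddSizeᵇ (f ∘ fs)

oddSizeᵇ-cong : (f g : Fin k → Bool) → (∀ x → f x ≡ g x) → oddSizeᵇ f ≡ oddSizeᵇ g
oddSizeᵇ-cong {zero}  f g f≗g = refl
oddSizeᵇ-cong {suc k} f g f≗g = cong₂ _xor_ (f≗g f0) (oddSizeᵇ-cong (f ∘ fs) (g ∘ fs) (f≗g ∘ fs))

oddSizeᵇ-xor : (f g : Fin k → Bool) → oddSizeᵇ (λ x → f x xor g x) ≡ oddSizeᵇ f xor oddSizeᵇ g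
oddSizeᵇ-xor {zero}  f g = refl
oddSizeᵇ-xor {suc k} f g =
  trans (cong ((f f0 xor g f0) xor_) (oddSizeᵇ-xor (f ∘ fs) (g ∘ fs))) (xor-interchange (f f0) (g f0) _ _)

oddSizeᵇ-empty : (f : Fin k → Bool) → (∀ x → f x ≡ false) → oddSizeᵇ f ≡ false
oddSizeᵇ-empty {zero}  f _     = refl
oddSizeᵇ-empty {suc k} f empty = cong₂ _xor_ (empty f0) (oddSizeᵇ-empty (f ∘ fs) (empty ∘ fs))

oddSizeᵇ-singleton : (a : Fin k) → oddSizeᵇ (λ x → does (a ≟ x)) ≡ true
oddSizeᵇ-singleton {suc k} f0     = cong (true xor_) (oddSizeᵇ-empty {k} _ (λ _ → refl))
oddSizeᵇ-singleton {suc k} (fs a) = trans (oddSizeᵇ-cong _ _ shift) (oddSizeᵇ-singleton a)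
  where
  shift : ∀ x → does (fs a ≟ fs x) ≡ does (a ≟ x)
  shift x with a ≟ x | fs a ≟ fs x
  ... | yes _   | yes _ = refl
  ... | no  _   | no  _ = refl
  ... | yes a≡x | no  ≢ = ⊥-elim (≢ (cong fs a≡x))
  ... | no  a≢x | yes ≡ = ⊥-elim (a≢x (fs-injective ≡))

oddSizeᵇ⇒nonempty : (f : Fin k → Bool) → oddSizeᵇ f ≡ true → ∃ λ x → f x ≡ true
oddSizeᵇ⇒nonempty {suc k} f odd with f f0 in f-f0
... | true  = f0 , f-f0
... | false = Product.map fs id (oddSizeᵇ⇒nonempty (f ∘ fs) odd)

oddSizeᵇ-full : ∀ k → oddSizeᵇ (λ (_ : Fin k) → true) ≡ oddᵇ k
oddSizeᵇ-full zero    = refl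
oddSizeᵇ-full (suc k) = cong not (oddSizeᵇ-full k)

occursᵇ : ℕ → (ℕ → Fin k) → Fin k → Bool
occursᵇ zero    s q = false
occursᵇ (suc j) s q = does (s 0 ≟ q) ∨ occursᵇ j (s ∘ suc) q

occursᵇ⁻ : ∀ j (s : ℕ → Fin k) q → occursᵇ j s q ≡ true → ∃ λ i → i < j × s i ≡ q
occursᵇ⁻ (suc j) s q occurs with s 0 ≟ q
... | yes s0≡q = 0 , s≤s z≤n , s0≡q
... | no  _    = Product.map suc (map₁ s≤s) (occursᵇ⁻ j (s ∘ suc) q occurs)

occursᵇ⁺ : ∀ j (s : ℕ → Fin k) i → i < j → occursᵇ j s (s i) ≡ true
occursᵇ⁺ (suc j) s zero    _ with s 0 ≟ s 0
... | yes _  = refl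
... | no  ≢  = ⊥-elim (≢ refl)
occursᵇ⁺ (suc j) s (suc i) (s≤s i<j) with s 0 ≟ s (suc i)
... | yes _ = refl
... | no  _ = occursᵇ⁺ j (s ∘ suc) i i<j

oddSizeᵇ-occurs : ∀ j (s : ℕ → Fin k) → (∀ a b → a < j → b < j → s a ≡ s b → a ≡ b) →
                  oddSizeᵇ (occursᵇ j s) ≡ oddᵇ j
oddSizeᵇ-occurs zero    s _         = oddSizeᵇ-empty (occursᵇ zero s) (λ _ → refl)
oddSizeᵇ-occurs (suc j) s injective = begin
  oddSizeᵇ (occursᵇ (suc j) s)                                       ≡⟨ oddSizeᵇ-cong _ _ head-xor-tail ⟩
  oddSizeᵇ (λ x → does (s 0 ≟ x) xor occursᵇ j (s ∘ suc) x)          ≡⟨ oddSizeᵇ-xor (λ x → does (s 0 ≟ x)) (occursᵇ j (s ∘ suc)) ⟩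
  oddSizeᵇ (λ x → does (s 0 ≟ x)) xor oddSizeᵇ (occursᵇ j (s ∘ suc)) ≡⟨ cong₂ _xor_ (oddSizeᵇ-singleton (s 0)) tail ⟩
  not (oddᵇ j)                                                        ∎
  where
  open ≡-Reasoning
  tail = oddSizeᵇ-occurs j (s ∘ suc) (λ a b a<j b<j e → suc-injective (injective (suc a) (suc b) (s≤s a<j) (s≤s b<j) e))
  head-xor-tail : ∀ x → occursᵇ (suc j) s x ≡ does (s 0 ≟ x) xor occursᵇ j (s ∘ suc) x
  head-xor-tail x with s 0 ≟ x
  ... | no  _    = refl
  ... | yes refl with occursᵇ j (s ∘ suc) (s 0) in again
  ...   | false = refl
  ...   | true with occursᵇ⁻ j (s ∘ suc) (s 0) again
  ...     | i , i<j , e with injective (suc i) 0 (s≤s i<j) (s≤s z≤n) e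
  ...       | ()

first-true : (P : ℕ → Bool) → ∀ n → (∀ i → i < n → P i ≡ false) ⊎
             (∃ λ j → j < n × P j ≡ true × (∀ i → i < j → P i ≡ false))
first-true P zero = inj₁ (λ _ ())
first-true P (suc n) with first-true P n
... | inj₂ (j , j<n , Pj , before) = inj₂ (j , ≤-trans j<n (n≤1+n n) , Pj , before)
... | inj₁ none with P n in Pn
...   | true  = inj₂ (n , ≤-refl , Pn , none)
...   | false = inj₁ λ i i<n+1 → Sum.[ none i , (λ { refl → Pn }) ] (m≤n⇒m<n∨m≡n (≤-pred i<n+1))

least-true : (P : ℕ → Bool) → ∀ n → P n ≡ true → ∃ λ j → P j ≡ true × (∀ i → i < j → P i ≡ false)
least-true P n Pn with first-true P (suc n)
... | inj₁ none                = ⊥-elim (not-¬ Pn (none n ≤-refl))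
... | inj₂ (j , _ , Pj , before) = j , Pj , before

triple : ∀ {a} {X : Set a} → X → X → X → Fin 3 → X
triple x y z f0           = x
triple x y z (fs f0)      = y
triple x y z (fs (fs f0)) = z

triple-injective : ∀ {a} {X : Set a} {x y z : X} → x ≢ y → x ≢ z → y ≢ z → Injective _≡_ _≡_ (triple x y z)
triple-injective x≢y x≢z y≢z {f0}         {f0}         _ = refl
triple-injective x≢y x≢z y≢z {f0}         {fs f0}      e = ⊥-elim (x≢y e)
triple-injective x≢y x≢z y≢z {f0}         {fs (fs f0)} e = ⊥-elim (x≢z e)
triple-injective x≢y x≢z y≢z {fs f0}      {f0}         e = ⊥-elim (x≢y (sym e))
triple-injective x≢y x≢z y≢z {fs f0}      {fs f0}      _ = refl
triple-injective x≢y x≢z y≢z {fs f0}      {fs (fs f0)} e = ⊥-elim (y≢z e)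
triple-injective x≢y x≢z y≢z {fs (fs f0)} {f0}         e = ⊥-elim (x≢z (sym e))
triple-injective x≢y x≢z y≢z {fs (fs f0)} {fs f0}      e = ⊥-elim (y≢z (sym e))
triple-injective x≢y x≢z y≢z {fs (fs f0)} {fs (fs f0)} _ = refl

C3⇒¬Balanced : ∀ {m n} (A : Matrix m n) → ContainsC3 A → ¬ Balanced A
C3⇒¬Balanced A (r , c , r-inj , c-inj , A≡C3) balanced =
  balanced (3 , (1 , refl) , r , c , r-inj , c-inj , row-count , column-count)
  where
  row-count : ∀ p → ∣ tabulate (λ q → A (r p) (c q)) ∣ ≡ 2
  row-count p = trans (cong ∣_∣ (tabulate-cong (A≡C3 p))) (C3-row p)
    where
    C3-row : ∀ p → ∣ tabulate (C3 p) ∣ ≡ 2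
    C3-row f0           = refl
    C3-row (fs f0)      = refl
    C3-row (fs (fs f0)) = refl
  column-count : ∀ q → ∣ tabulate (λ p → A (r p) (c q)) ∣ ≡ 2
  column-count q = trans (cong ∣_∣ (tabulate-cong (λ p → A≡C3 p q))) (C3-column q)
    where
    C3-column : ∀ q → ∣ tabulate (λ p → C3 p q) ∣ ≡ 2
    C3-column f0           = refl
    C3-column (fs f0)      = refl
    C3-column (fs (fs f0)) = refl

-- Columns c₀, …, c_L of A, each two cyclically consecutive ones lying in a row that meets
-- no other column of the cycle; with these rows, an odd cycle is an odd 2-regular submatrix.
record ColumnCycle {m n} (A : Matrix m n) (L : ℕ) : Set where
  field
    column           : Fin (suc L) → Fin n
    column-injective : Injective _≡_ _≡_ column
    link             : ∀ i → ∃ λ R → A R (column i) ≡ true × A R (column (next i)) ≡ true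
    link-only        : ∀ i s R → A R (column i) ≡ true → A R (column (next i)) ≡ true →
                       A R (column s) ≡ true → s ≡ i ⊎ s ≡ next i

  row : Fin (suc L) → Fin m
  row i = proj₁ (link i)

  row-here : ∀ i → A (row i) (column i) ≡ true
  row-here i = proj₁ (proj₂ (link i))

  row-next : ∀ i → A (row i) (column (next i)) ≡ true
  row-next i = proj₂ (proj₂ (link i))

HasOddCycle : ∀ {m n} → Matrix m n → Set
HasOddCycle A = ∃ λ L → 2 ≤ L × Odd (suc L) × ColumnCycle A L

oddCycle⇒¬Balanced : ∀ {m n} {A : Matrix m n} → ColumnCycle A L → 2 ≤ L → Odd (suc L) → ¬ Balanced A
oddCycle⇒¬Balanced {L} {A = A} cycle 2≤L odd balanced =
  balanced (suc L , odd , row , column , row-injective , column-injective , row-count , column-count)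
  where
  open ColumnCycle cycle
  1≤L = ≤-trans (s≤s z≤n) 2≤L
  row-only : ∀ i s → A (row i) (column s) ≡ true → s ≡ i ⊎ s ≡ next i
  row-only i s = link-only i s (row i) (row-here i) (row-next i)
  row-injective : Injective _≡_ _≡_ row
  row-injective {i} {j} e
    with row-only i j (subst (λ R → A R (column j) ≡ true) (sym e) (row-here j))
       | row-only i (next j) (subst (λ R → A R (column (next j)) ≡ true) (sym e) (row-next j))
  ... | inj₁ j≡i   | _            = sym j≡i
  ... | inj₂ j≡i+1 | inj₁ j+1≡i   = ⊥-elim (next²-≢ 2≤L i (trans (cong next (sym j≡i+1)) j+1≡i))
  ... | inj₂ _     | inj₂ j+1≡i+1 = sym (next-injective j+1≡i+1)
  row-count : ∀ p → ∣ tabulate (λ q → A (row p) (column q)) ∣ ≡ 2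
  row-count p = doubleton⇒∣p∣≡2 (tabulate g) p (next p)
    ( (λ e → next-≢ 1≤L p (sym e))
    , ∈-tabulate⁺ g (row-here p) , ∈-tabulate⁺ g (row-next p)
    , λ q q∈ → row-only p q (∈-tabulate⁻ g q∈))
    where g = λ q → A (row p) (column q)
  column-count : ∀ q → ∣ tabulate (λ p → A (row p) (column q)) ∣ ≡ 2
  column-count q = doubleton⇒∣p∣≡2 (tabulate g) q (prev q)
    ( (λ e → next-≢ 1≤L q (trans (cong next e) (next-prev q)))
    , ∈-tabulate⁺ g (row-here q)
    , ∈-tabulate⁺ g (subst (λ z → A (row (prev q)) (column z) ≡ true) (next-prev q) (row-next (prev q)))
    , λ p p∈ → neighbour (row-only p q (∈-tabulate⁻ g p∈)))
    where
    g = λ p → A (row p) (column q)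
    neighbour : ∀ {p} → q ≡ p ⊎ q ≡ next p → p ≡ q ⊎ p ≡ prev q
    neighbour (inj₁ e) = inj₁ (sym e)
    neighbour {p} (inj₂ e) = inj₂ (trans (sym (prev-next p)) (cong prev (sym e)))

IntersectionGraph-sym : ∀ {m n} (A : Matrix m n) a b → IntersectionGraph A a b → IntersectionGraph A b a
IntersectionGraph-sym A a b (a≢b , R , Ra , Rb) = a≢b ∘ sym , R , Rb , Ra

module _ {m n} (A : Matrix m n) where

  private
    G : Graph n
    G = IntersectionGraph A

  hole⇒cycle : 3 ≤ L → InducedSub (CycleGraph (suc L)) G → ColumnCycle A L
  hole⇒cycle 3≤L (f , f-inj , f-induced) = record
    { column = f ; column-injective = f-inj ; link = link ; link-only = link-only }
    where
    link : ∀ i → ∃ λ R → A R (f i) ≡ true × A R (f (next i)) ≡ true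
    link i = proj₂ (Equivalence.from (f-induced i (next i)) (CycleGraph-next i))
    link-only : ∀ i s R → A R (f i) ≡ true → A R (f (next i)) ≡ true → A R (f s) ≡ true → s ≡ i ⊎ s ≡ next i
    link-only i s R Ri Ri+1 Rs with s ≟ i | s ≟ next i
    ... | yes s≡i | _          = inj₁ s≡i
    ... | no _    | yes s≡i+1  = inj₂ s≡i+1
    ... | no s≢i  | no s≢i+1   = ⊥-elim (CycleGraph-triangle-free i s 3≤L
            (Equivalence.to (f-induced s i) (s≢i ∘ f-inj , R , Rs , Ri))
            (Equivalence.to (f-induced s (next i)) (s≢i+1 ∘ f-inj , R , Rs , Ri+1)))

  oddHole⇒¬Balanced : HasOddHole G → ¬ Balanced A
  oddHole⇒¬Balanced (suc L , s≤s 3≤L , odd , hole) =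
    oddCycle⇒¬Balanced (hole⇒cycle 3≤L hole) (≤-trans (s≤s (s≤s z≤n)) 3≤L) odd

  -- Rim edges are maximal cliques, so no third rim vertex lies in the row of a rim edge.
  multisun⇒cycle : (H : Graph (suc L)) → IsMultisun H → InducedSub H G → ColumnCycle A L
  multisun⇒cycle {L} H (_ , _ , 3≤k , _ , σ , σ-inj , rim , _) (f , f-inj , f-induced) = record
    { column = f ∘ σ ; column-injective = σ-inj ∘ f-inj ; link = link ; link-only = link-only }
    where
    1≤L : 1 ≤ L
    1≤L = ≤-trans (s≤s z≤n) (≤-pred 3≤k)
    rim-clique : ∀ i → IsMaxClique H (pair (σ i) (σ (next i))) × ∣ pair (σ i) (σ (next i)) ∣ ≡ 2
    rim-clique i = Equivalence.from (rim (pair (σ i) (σ (next i))))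
      (σ i , σ (next i) , (i , next i , CycleGraph-next i , refl , refl) , refl)
    link : ∀ i → ∃ λ R → A R (f (σ i)) ≡ true × A R (f (σ (next i))) ≡ true
    link i = proj₂ (Equivalence.from (f-induced (σ i) (σ (next i)))
      (proj₁ (proj₁ (rim-clique i)) (σ i) (σ (next i)) (left∈pair _ _) (right∈pair _ _)
        (next-≢ 1≤L i ∘ sym ∘ σ-inj)))
    link-only : ∀ i s R → A R (f (σ i)) ≡ true → A R (f (σ (next i))) ≡ true → A R (f (σ s)) ≡ true →
                s ≡ i ⊎ s ≡ next i
    link-only i s R Ri Ri+1 Rs with s ≟ i | s ≟ next i
    ... | yes s≡i | _         = inj₁ s≡i
    ... | no _    | yes s≡i+1 = inj₂ s≡i+1
    ... | no s≢i  | no s≢i+1  = ⊥-elim (proj₂ (proj₁ (rim-clique i)) (σ s) outside-pair adjacent)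
      where
      outside-pair : σ s ∉ pair (σ i) (σ (next i))
      outside-pair s∈ = Sum.[ s≢i ∘ σ-inj , s≢i+1 ∘ σ-inj ] (∈-pair⁻ s∈)
      adjacent : ∀ u → u ∈ pair (σ i) (σ (next i)) → H u (σ s)
      adjacent u u∈ with ∈-pair⁻ u∈
      ... | inj₁ refl = Equivalence.to (f-induced (σ i) (σ s)) (s≢i ∘ sym ∘ σ-inj ∘ f-inj , R , Ri , Rs)
      ... | inj₂ refl = Equivalence.to (f-induced (σ (next i)) (σ s)) (s≢i+1 ∘ sym ∘ σ-inj ∘ f-inj , R , Ri+1 , Rs)

  HOHFreeMultisun⇒¬Balanced : ContainsHOHFreeMultisun G → ¬ Balanced A
  HOHFreeMultisun⇒¬Balanced (suc L , H , (multisun , _) , H⊆G) with multisun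
  ... | (_ , odd , s≤s 2≤L , _) = oddCycle⇒¬Balanced (multisun⇒cycle H multisun H⊆G) 2≤L odd

module _ {m n} {A : Matrix m n} (linear : Linear A) where

  private
    G : Graph n
    G = IntersectionGraph A

  row-unique : ∀ {R R′ a b} → A R a ≡ true → A R b ≡ true → A R′ a ≡ true → A R′ b ≡ true → a ≢ b → R ≡ R′
  row-unique {R} {R′} {a} {b} Ra Rb R′a R′b a≢b with R ≟ R′
  ... | yes R≡R′ = R≡R′
  ... | no  R≢R′ = ⊥-elim (linear (R , R′ , a , b , R≢R′ , a≢b , Ra , Rb , R′a , R′b))

  -- The rows witnessing the edges ac and bc complete R to a C₃ on the columns a, b, c.
  open-triangle⇒C3 : ∀ a b c → a ≢ b → a ≢ c → b ≢ c → G a c → G b c →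
    ∀ R → A R a ≡ true → A R b ≡ true → A R c ≡ false → ContainsC3 A
  open-triangle⇒C3 a b c a≢b a≢c b≢c (_ , Rac , Raca , Racc) (_ , Rbc , Rbcb , Rbcc) R Ra Rb Rc =
    triple R Rbc Rac , triple a b c , triple-injective R≢Rbc R≢Rac Rbc≢Rac , triple-injective a≢b a≢c b≢c , entries
    where
    Rc≢true : A R c ≢ true
    Rc≢true = not-¬ Rc
    Racb : A Rac b ≢ true
    Racb Racb = Rc≢true (subst (λ z → A z c ≡ true) (row-unique Raca Racb Ra Rb a≢b) Racc)
    Rbca : A Rbc a ≢ true
    Rbca Rbca = Rc≢true (subst (λ z → A z c ≡ true) (row-unique Rbca Rbcb Ra Rb a≢b) Rbcc)
    R≢Rbc : R ≢ Rbc
    R≢Rbc e = Rc≢true (subst (λ z → A z c ≡ true) (sym e) Rbcc)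
    R≢Rac : R ≢ Rac
    R≢Rac e = Rc≢true (subst (λ z → A z c ≡ true) (sym e) Racc)
    Rbc≢Rac : Rbc ≢ Rac
    Rbc≢Rac e = Rbca (subst (λ z → A z a ≡ true) (sym e) Raca)
    entries : ∀ p q → A (triple R Rbc Rac p) (triple a b c q) ≡ C3 p q
    entries f0           f0           = Ra
    entries f0           (fs f0)      = Rb
    entries f0           (fs (fs f0)) = Rc
    entries (fs f0)      f0           = ¬-not Rbca
    entries (fs f0)      (fs f0)      = Rbcb
    entries (fs f0)      (fs (fs f0)) = Rbcc
    entries (fs (fs f0)) f0           = Raca
    entries (fs (fs f0)) (fs f0)      = ¬-not Racb
    entries (fs (fs f0)) (fs (fs f0)) = Racc

  row-closes-triangle : ¬ ContainsC3 A → ∀ a b c → a ≢ b → a ≢ c → b ≢ c → G a c → G b c →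
    ∀ R → A R a ≡ true → A R b ≡ true → A R c ≡ true
  row-closes-triangle noC3 a b c a≢b a≢c b≢c ac bc R Ra Rb with A R c in Rc
  ... | true  = refl
  ... | false = ⊥-elim (noC3 (open-triangle⇒C3 a b c a≢b a≢c b≢c ac bc R Ra Rb Rc))

  -- A row through the middle edge of a diamond misses one of the two tips, or it would join them.
  diamond⇒C3 : InducedSub Diamond G → ContainsC3 A
  diamond⇒C3 (f , f-inj , f-induced) = tips refl refl
    where
    x₀ x₁ x₂ x₃ : Fin 4
    x₀ = f0
    x₁ = fs f0
    x₂ = fs (fs f0)
    x₃ = fs (fs (fs f0))
    edge : ∀ a b → Diamond a b → G (f a) (f b)
    edge a b = Equivalence.from (f-induced a b)
    distinct : ∀ {a b} → a ≢ b → f a ≢ f b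
    distinct a≢b = a≢b ∘ f-inj
    R = proj₁ (proj₂ (edge x₁ x₂ _))
    R₁ = proj₁ (proj₂ (proj₂ (edge x₁ x₂ _)))
    R₂ = proj₂ (proj₂ (proj₂ (edge x₁ x₂ _)))
    tips : ∀ {b₀ b₃} → A R (f x₀) ≡ b₀ → A R (f x₃) ≡ b₃ → ContainsC3 A
    tips {false} R₀ _ =
      open-triangle⇒C3 (f x₁) (f x₂) (f x₀) (distinct λ ()) (distinct λ ()) (distinct λ ())
        (IntersectionGraph-sym A _ _ (edge x₀ x₁ _)) (IntersectionGraph-sym A _ _ (edge x₀ x₂ _)) R R₁ R₂ R₀
    tips {true} {false} _ R₃ =
      open-triangle⇒C3 (f x₁) (f x₂) (f x₃) (distinct λ ()) (distinct λ ()) (distinct λ ())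
        (edge x₁ x₃ _) (edge x₂ x₃ _) R R₁ R₂ R₃
    tips {true} {true} R₀ R₃ = ⊥-elim (Equivalence.to (f-induced x₀ x₃) (distinct (λ ()) , R , R₀ , R₃))

  -- The row R closes the arc a, next a, …, next^d a = b into a cycle of its own.
  cycle-shortcut : ∀ {L} (cycle : ColumnCycle A L) (a b : Fin (suc L)) d → next^ d a ≡ b → 1 ≤ d → d < suc L →
    let open ColumnCycle cycle in
    ∀ R → A R (column a) ≡ true → A R (column b) ≡ true →
    (∀ s → A R (column s) ≡ true → s ≡ a ⊎ s ≡ b) → ColumnCycle A d
  cycle-shortcut {L} cycle a b d d-steps 1≤d d<L R Ra Rb R-only = record
    { column = column′ ; column-injective = column′-injective ; link = link′ ; link-only = link′-only }
    where
    open ColumnCycle cycle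
    arc : ℕ → Fin (suc L)
    arc t = next^ t a
    column′ : Fin (suc d) → Fin n
    column′ t = column (arc (toℕ t))
    below : (t : Fin (suc d)) → toℕ t < suc L
    below t = ≤-trans (toℕ<n t) d<L
    arc-injective : ∀ s t → arc (toℕ s) ≡ arc (toℕ t) → s ≡ t
    arc-injective s t e = toℕ-injective (next^-injective-below a (toℕ s) (toℕ t) (below s) (below t) e)
    column′-injective : Injective _≡_ _≡_ column′
    column′-injective {s} {t} = arc-injective s t ∘ column-injective
    a≢b : column a ≢ column b
    a≢b e = <-irrefl (next^-injective-below a 0 d (s≤s z≤n) d<L (trans (column-injective e) (sym d-steps))) 1≤d
    arc-end : (t : Fin (suc d)) → suc (toℕ t) ≡ suc d → arc (toℕ t) ≡ b
    arc-end t e = trans (cong arc (suc-injective e)) d-steps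
    link′ : ∀ t → ∃ λ R′ → A R′ (column′ t) ≡ true × A R′ (column′ (next t)) ≡ true
    link′ t with toℕ-next-cases t
    ... | inj₁ e = let (R′ , R′t , R′t+1) = link (arc (toℕ t)) in
                   R′ , R′t , subst (λ z → A R′ (column (arc z)) ≡ true) e R′t+1
    ... | inj₂ (e₀ , e) = R , subst (λ z → A R (column z) ≡ true) (sym (arc-end t e)) Rb ,
                              subst (λ z → A R (column (arc z)) ≡ true) (sym e₀) Ra
    link′-only : ∀ t s R′ → A R′ (column′ t) ≡ true → A R′ (column′ (next t)) ≡ true → A R′ (column′ s) ≡ true →
                 s ≡ t ⊎ s ≡ next t
    link′-only t s R′ R′t R′t+1 R′s with toℕ-next-cases t
    ... | inj₁ e = Sum.map (arc-injective s t) (λ s≡ → arc-injective s (next t) (trans s≡ (cong arc e)))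
                     (link-only (arc (toℕ t)) (arc (toℕ s)) R′ R′t
                       (subst (λ z → A R′ (column (arc z)) ≡ true) (sym e) R′t+1) R′s)
    ... | inj₂ (e₀ , e) = Sum.swap (Sum.map
                            (λ s≡a → arc-injective s (next t) (trans s≡a (cong arc (sym e₀))))
                            (λ s≡b → arc-injective s t (trans s≡b (sym (arc-end t e))))
                            (R-only (arc (toℕ s)) (subst (λ z → A z (column (arc (toℕ s))) ≡ true) R′≡R R′s)))
      where
      R′≡R : R′ ≡ R
      R′≡R = row-unique (subst (λ z → A R′ (column z) ≡ true) (arc-end t e) R′t)
                        (subst (λ z → A R′ (column (arc z)) ≡ true) e₀ R′t+1) Rb Ra (a≢b ∘ sym)

  -- With no C₃ and no shorter odd cycle, the intersection graph induced on a shortest odd cycle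
  -- is an HOH-free multisun whose rim is the cycle itself.
  module ShortestOddCycle (noC3 : ¬ ContainsC3 A) {L} (cycle : ColumnCycle A L) (2≤L : 2 ≤ L) (odd : Odd (suc L))
    (shortest : ∀ {L′} → L′ < L → 2 ≤ L′ → Odd (suc L′) → ¬ ColumnCycle A L′) where

    open ColumnCycle cycle

    1≤L : 1 ≤ L
    1≤L = ≤-trans (s≤s z≤n) 2≤L

    H : Graph (suc L)
    H a b = G (column a) (column b)

    H-sym : ∀ a b → H a b → H b a
    H-sym a b = IntersectionGraph-sym A (column a) (column b)

    column-≢ : ∀ {a b} → a ≢ b → column a ≢ column b
    column-≢ a≢b = a≢b ∘ column-injective

    rim-edge : ∀ i → H i (next i)
    rim-edge i = column-≢ (next-≢ 1≤L i ∘ sym) , row i , row-here i , row-next i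

    rim-edge-in-no-triangle : ∀ i w → w ≢ i → w ≢ next i → H w i → H w (next i) → ⊥
    rim-edge-in-no-triangle i w w≢i w≢i+1 wi wi+1 with A (row i) (column w) in Rw
    ... | true  = Sum.[ w≢i , w≢i+1 ] (link-only i w (row i) (row-here i) (row-next i) Rw)
    ... | false = noC3 (open-triangle⇒C3 (column i) (column (next i)) (column w) (column-≢ (next-≢ 1≤L i ∘ sym))
                    (column-≢ (w≢i ∘ sym)) (column-≢ (w≢i+1 ∘ sym)) (H-sym _ _ wi) (H-sym _ _ wi+1)
                    (row i) (row-here i) (row-next i) Rw)

    -- The chord uw splits the cycle into two arcs of lengths d and e with d + e = L + 1 odd;
    -- closing the odd one by the row of the chord gives a shorter odd cycle.
    no-chord : ∀ u w → u ≢ w → w ≢ next u → u ≢ next w → ∀ R → A R (column u) ≡ true → A R (column w) ≡ true →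
               (∀ s → A R (column s) ≡ true → s ≡ u ⊎ s ≡ w) → ⊥
    no-chord u w u≢w w≢u+1 u≢w+1 R Ru Rw R-only = split (next^-reach u w)
      where
      split : (∃ λ d → d < suc L × next^ d u ≡ w) → ⊥
      split (zero , _ , u≡w) = u≢w u≡w
      split (suc zero , _ , u+1≡w) = w≢u+1 (sym u+1≡w)
      split (d@(suc (suc _)) , d<L+1 , d-steps) =
        Sum.[ close-first , close-second ] (Odd-+⇒Odd-suc d e (subst Odd (sym d+e≡L+1) odd))
        where
        e = suc L ∸ d
        e+d≡L+1 : e + d ≡ suc L
        e+d≡L+1 = m∸n+n≡m (<⇒≤ d<L+1)
        d+e≡L+1 : d + e ≡ suc L
        d+e≡L+1 = trans (+-comm d e) e+d≡L+1
        d≢L : d ≢ L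
        d≢L d≡L = u≢w+1 (sym (trans (cong next (sym prev-u≡w)) (next-prev u)))
          where prev-u≡w = trans (cong (λ z → next^ z u) (sym d≡L)) d-steps
        d<L : d < L
        d<L = ≤∧≢⇒< (≤-pred d<L+1) d≢L
        2≤e : 2 ≤ e
        2≤e = proj₁ (complement-bounds d (s≤s (s≤s z≤n)) d<L)
        e<L : e < L
        e<L = proj₂ (complement-bounds d (s≤s (s≤s z≤n)) d<L)
        e-steps : next^ e w ≡ u
        e-steps = begin
          next^ e w               ≡⟨ cong (next^ e) d-steps ⟨
          next^ e (next^ d u)     ≡⟨ next^-+ e d u ⟨
          next^ (e + d) u         ≡⟨ cong (λ z → next^ z u) e+d≡L+1 ⟩
          next^ (suc L) u         ≡⟨ next^-period u ⟩
          u                       ∎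
          where open ≡-Reasoning
        close-first : Odd (suc d) → ⊥
        close-first odd-d = shortest d<L (s≤s (s≤s z≤n)) odd-d
          (cycle-shortcut cycle u w d d-steps (s≤s z≤n) d<L+1 R Ru Rw R-only)
        close-second : Odd (suc e) → ⊥
        close-second odd-e = shortest e<L 2≤e odd-e
          (cycle-shortcut cycle w u e e-steps (≤-trans (s≤s z≤n) 2≤e) (≤-trans e<L (n≤1+n L)) R Rw Ru
            (λ s → Sum.swap ∘ R-only s))

    Consecutive : Fin (suc L) → Fin (suc L) → Set
    Consecutive x y = y ≡ next x ⊎ x ≡ next y

    consecutive-adjacent : ∀ x y → Consecutive x y → H x y
    consecutive-adjacent x y (inj₁ refl) = rim-edge x
    consecutive-adjacent x y (inj₂ refl) = H-sym _ _ (rim-edge y)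

    consecutive-≢ : ∀ x y → Consecutive x y → x ≢ y
    consecutive-≢ x y (inj₁ refl) = next-≢ 1≤L x ∘ sym
    consecutive-≢ x y (inj₂ refl) = next-≢ 1≤L y

    consecutive-in-no-triangle : ∀ x y w → Consecutive x y → w ≢ x → w ≢ y → H w x → H w y → ⊥
    consecutive-in-no-triangle x y w (inj₁ refl) w≢x w≢y wx wy = rim-edge-in-no-triangle x w w≢x w≢y wx wy
    consecutive-in-no-triangle x y w (inj₂ refl) w≢x w≢y wx wy = rim-edge-in-no-triangle y w w≢y w≢x wy wx

    RimAdj⇔Consecutive : ∀ x y → RimAdj id x y ⇔ Consecutive x y
    RimAdj⇔Consecutive x y = mk⇔ (λ { (i , j , i~j , refl , refl) → CycleGraph⇒next i j i~j })
                                 (λ c → x , y , next⇒CycleGraph x y c , refl , refl)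

    rim-clique : ∀ x y → Consecutive x y → IsMaxClique H (pair x y) × ∣ pair x y ∣ ≡ 2
    rim-clique x y c = (clique , maximal) , ∣pair∣≡2 x y (consecutive-≢ x y c)
      where
      clique : IsClique H (pair x y)
      clique u w u∈ w∈ u≢w with ∈-pair⁻ u∈ | ∈-pair⁻ w∈
      ... | inj₁ refl | inj₁ refl = ⊥-elim (u≢w refl)
      ... | inj₁ refl | inj₂ refl = consecutive-adjacent x y c
      ... | inj₂ refl | inj₁ refl = H-sym _ _ (consecutive-adjacent x y c)
      ... | inj₂ refl | inj₂ refl = ⊥-elim (u≢w refl)
      maximal : ∀ w → w ∉ pair x y → ¬ (∀ u → u ∈ pair x y → H u w)
      maximal w w∉ all = consecutive-in-no-triangle x y w c
        (λ { refl → w∉ (left∈pair x y) }) (λ { refl → w∉ (right∈pair x y) })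
        (H-sym _ _ (all x (left∈pair x y))) (H-sym _ _ (all y (right∈pair x y)))

    pair-extensional : ∀ {Q : Subset (suc L)} {u w} → (∀ {x} → x ∈ Q → x ≡ u ⊎ x ≡ w) → u ∈ Q → w ∈ Q → Q ≡ pair u w
    pair-extensional {u = u} {w} only u∈ w∈ = ⊆-antisym
      (λ x∈ → Sum.[ (λ { refl → left∈pair u w }) , (λ { refl → right∈pair u w }) ] (only x∈))
      (λ x∈ → Sum.[ (λ { refl → u∈ }) , (λ { refl → w∈ }) ] (∈-pair⁻ x∈))

    -- The row of an edge uw forming a maximal clique meets the cycle only in u and w,
    -- so no-chord forces u and w to be consecutive.
    maximal-pair⇒consecutive : ∀ {Q} → IsMaxClique H Q → ∀ u w → IsDoubleton Q u w → Consecutive u w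
    maximal-pair⇒consecutive {Q} (clique , maximal) u w (u≢w , u∈ , w∈ , only)
      with w ≟ next u | u ≟ next w
    ... | yes w≡u+1 | _         = inj₁ w≡u+1
    ... | no _      | yes u≡w+1 = inj₂ u≡w+1
    ... | no w≢u+1  | no u≢w+1  = ⊥-elim (no-chord u w u≢w w≢u+1 u≢w+1 R Ru Rw R-only)
      where
      R = proj₁ (proj₂ (clique u w u∈ w∈ u≢w))
      Ru = proj₁ (proj₂ (proj₂ (clique u w u∈ w∈ u≢w)))
      Rw = proj₂ (proj₂ (proj₂ (clique u w u∈ w∈ u≢w)))
      R-only : ∀ s → A R (column s) ≡ true → s ≡ u ⊎ s ≡ w
      R-only s Rs with s ≟ u | s ≟ w
      ... | yes s≡u | _       = inj₁ s≡u
      ... | no _    | yes s≡w = inj₂ s≡w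
      ... | no s≢u  | no s≢w  = ⊥-elim (maximal s (λ s∈ → Sum.[ s≢u , s≢w ] (only s s∈)) adjacent)
        where
        adjacent : ∀ x → x ∈ Q → H x s
        adjacent x x∈ with only x x∈
        ... | inj₁ refl = column-≢ (s≢u ∘ sym) , R , Ru , Rs
        ... | inj₂ refl = column-≢ (s≢w ∘ sym) , R , Rw , Rs

    rim-cliques : ∀ Q → (IsMaxClique H Q × ∣ Q ∣ ≡ 2) ⇔
                  (∃ λ u → ∃ λ w → RimAdj id u w × Q ≡ pair u w)
    rim-cliques Q = mk⇔ to from
      where
      to : IsMaxClique H Q × ∣ Q ∣ ≡ 2 → ∃ λ u → ∃ λ w → RimAdj id u w × Q ≡ pair u w
      to (maximal , ∣Q∣≡2) with ∣p∣≡2⇒doubleton Q ∣Q∣≡2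
      ... | u , w , is-doubleton@(_ , u∈ , w∈ , only) =
        u , w , Equivalence.from (RimAdj⇔Consecutive u w) (maximal-pair⇒consecutive maximal u w is-doubleton) ,
        pair-extensional (only _) u∈ w∈
      from : (∃ λ u → ∃ λ w → RimAdj id u w × Q ≡ pair u w) → IsMaxClique H Q × ∣ Q ∣ ≡ 2
      from (u , w , adj , refl) = rim-clique u w (Equivalence.to (RimAdj⇔Consecutive u w) adj)

    inscribed-nonconsecutive : ∀ Q → Inscribed H Q → ∀ u w → u ∈ Q → w ∈ Q → ¬ RimAdj id u w
    inscribed-nonconsecutive Q ((clique , _) , ∣Q∣≢2) u w u∈ w∈ adj =
      ∣Q∣≢2 (trans (cong ∣_∣ (pair-extensional only u∈ w∈)) (proj₂ (rim-clique u w c)))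
      where
      c = Equivalence.to (RimAdj⇔Consecutive u w) adj
      only : ∀ {x} → x ∈ Q → x ≡ u ⊎ x ≡ w
      only {x} x∈ with x ≟ u | x ≟ w
      ... | yes x≡u | _       = inj₁ x≡u
      ... | no _    | yes x≡w = inj₂ x≡w
      ... | no x≢u  | no x≢w  = ⊥-elim (consecutive-in-no-triangle u w x c x≢u x≢w
                                   (clique x u x∈ u∈ x≢u) (clique x w x∈ w∈ x≢w))

    -- Every vertex adjacent to both ends of an edge uw lies in the row of uw (no C₃), so two
    -- maximal cliques through the same edge coincide.
    maximal-clique-unique : ∀ Q₁ Q₂ → IsMaxClique H Q₁ → IsMaxClique H Q₂ → ∀ u w → u ≢ w →
      u ∈ Q₁ → w ∈ Q₁ → u ∈ Q₂ → w ∈ Q₂ → ∀ {x} → x ∈ Q₁ → x ∈ Q₂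
    maximal-clique-unique Q₁ Q₂ (clique₁ , _) (clique₂ , maximal₂) u w u≢w u∈₁ w∈₁ u∈₂ w∈₂ {x} x∈₁
      with x ∈? Q₂
    ... | yes x∈₂ = x∈₂
    ... | no  x∉₂ = ⊥-elim (maximal₂ x x∉₂ adjacent)
      where
      R = proj₁ (proj₂ (clique₁ u w u∈₁ w∈₁ u≢w))
      Ru = proj₁ (proj₂ (proj₂ (clique₁ u w u∈₁ w∈₁ u≢w)))
      Rw = proj₂ (proj₂ (proj₂ (clique₁ u w u∈₁ w∈₁ u≢w)))
      in-row : ∀ y {Q} → IsClique H Q → u ∈ Q → w ∈ Q → y ∈ Q → y ≢ u → y ≢ w → A R (column y) ≡ true
      in-row y clique u∈ w∈ y∈ y≢u y≢w =
        row-closes-triangle noC3 (column u) (column w) (column y) (column-≢ u≢w)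
          (column-≢ (y≢u ∘ sym)) (column-≢ (y≢w ∘ sym))
          (clique u y u∈ y∈ (y≢u ∘ sym)) (clique w y w∈ y∈ (y≢w ∘ sym)) R Ru Rw
      x≢u : x ≢ u
      x≢u refl = x∉₂ u∈₂
      x≢w : x ≢ w
      x≢w refl = x∉₂ w∈₂
      adjacent : ∀ y → y ∈ Q₂ → H y x
      adjacent y y∈₂ with y ≟ u | y ≟ w
      ... | yes refl | _        = clique₁ u x u∈₁ x∈₁ (x≢u ∘ sym)
      ... | no _     | yes refl = clique₁ w x w∈₁ x∈₁ (x≢w ∘ sym)
      ... | no y≢u   | no y≢w   = column-≢ (λ { refl → x∉₂ y∈₂ }) , R ,
                                    in-row y clique₂ u∈₂ w∈₂ y∈₂ y≢u y≢w , in-row x clique₁ u∈₁ w∈₁ x∈₁ x≢u x≢w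

    maximal-clique-has-edge : ∀ Q → IsMaxClique H Q → ∃ λ u → ∃ λ w → u ≢ w × u ∈ Q × w ∈ Q
    maximal-clique-has-edge Q (_ , maximal) with any? (_∈? Q)
    ... | no empty = ⊥-elim (maximal f0 (λ f0∈ → empty (f0 , f0∈)) (λ u u∈ → ⊥-elim (empty (u , u∈))))
    ... | yes (u , u∈) with any? (λ x → x ∈? Q ×-dec ¬? (x ≟ u))
    ...   | yes (w , w∈ , w≢u) = u , w , w≢u ∘ sym , u∈ , w∈
    ...   | no singleton = ⊥-elim (maximal (next u) (λ u+1∈ → singleton (next u , u+1∈ , next-≢ 1≤L u)) adjacent)
      where
      adjacent : ∀ y → y ∈ Q → H y (next u)
      adjacent y y∈ with y ≟ u
      ... | yes refl = rim-edge u
      ... | no y≢u = ⊥-elim (singleton (y , y∈ , y≢u))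

    module SubMultisun (D : Subset (suc L) → Bool) (deleted-inscribed : ∀ Q → D Q ≡ true → Inscribed H Q)
                       (Q₀ : Subset (suc L)) (Q₀-inscribed : Inscribed H Q₀) (Q₀-kept : D Q₀ ≡ false) where

      H′ : Graph (suc L)
      H′ = DeleteCliques H D

      H′-sym : ∀ x y → H′ x y → H′ y x
      H′-sym x y (xy , undeleted) = H-sym x y xy , λ { (Q , DQ , y∈ , x∈) → undeleted (Q , DQ , x∈ , y∈) }

      -- A deleted clique through z and x would have to contain y as well (no C₃), deleting xy.
      survives-along-row : ∀ x y z R → y ≢ z → x ≢ z →
        A R (column x) ≡ true → A R (column y) ≡ true → A R (column z) ≡ true → H′ x y → H′ z x
      survives-along-row x y z R y≢z x≢z Rx Ry Rz (xy , xy-undeleted) =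
        (column-≢ (x≢z ∘ sym) , R , Rz , Rx) , zx-undeleted
        where
        zx-undeleted : ¬ (∃ λ Q → D Q ≡ true × z ∈ Q × x ∈ Q)
        zx-undeleted (Q , DQ , z∈ , x∈) with y ∈? Q
        ... | yes y∈ = xy-undeleted (Q , DQ , x∈ , y∈)
        ... | no  y∉ = maximal y y∉ adjacent
          where
          clique = proj₁ (proj₁ (deleted-inscribed Q DQ))
          maximal = proj₂ (proj₁ (deleted-inscribed Q DQ))
          adjacent : ∀ u → u ∈ Q → H u y
          adjacent u u∈ with u ≟ x | u ≟ z
          ... | yes refl | _        = xy
          ... | no _     | yes refl = column-≢ (y≢z ∘ sym) , R , Rz , Ry
          ... | no u≢x   | no u≢z   = column-≢ (λ { refl → y∉ u∈ }) , R ,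
                  row-closes-triangle noC3 (column x) (column z) (column u) (column-≢ x≢z)
                    (column-≢ (u≢x ∘ sym)) (column-≢ (u≢z ∘ sym))
                    (H-sym _ _ (clique u x u∈ x∈ u≢x)) (H-sym _ _ (clique u z u∈ z∈ u≢z)) R Rx Rz , Ry

      -- A hole through all vertices would give a vertex of the kept inscribed clique Q₀ three
      -- neighbours in H′: its two rim neighbours and another vertex of Q₀.
      no-spanning-hole : ∀ {L′} → L′ ≡ L → (g : Fin (suc L′) → Fin (suc L)) → Injective _≡_ _≡_ g →
                         (∀ a b → H′ (g a) (g b) ⇔ CycleGraph (suc L′) a b) → ⊥
      no-spanning-hole refl g g-inj g-induced with maximal-clique-has-edge Q₀ (proj₁ Q₀-inscribed)
      ... | u , w , u≢w , u∈ , w∈ =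
        two-neighbours-at-most (neighbour (rim-survives (inj₁ refl)))
          (neighbour (rim-survives (inj₂ (sym (next-prev u))))) (neighbour chord-survives)
          (λ e → next²-≢ 2≤L u (trans (cong next e) (next-prev u)))
          (λ u+1≡w → not-rim (inj₁ (sym u+1≡w)))
          (λ u-1≡w → not-rim (inj₂ (trans (sym (next-prev u)) (cong next u-1≡w))))
        where
        Q₀-maximal = proj₁ Q₀-inscribed
        not-rim : ¬ Consecutive u w
        not-rim = inscribed-nonconsecutive Q₀ Q₀-inscribed u w u∈ w∈ ∘ Equivalence.from (RimAdj⇔Consecutive u w)
        rim-survives : ∀ {z} → Consecutive u z → H′ u z
        rim-survives c = consecutive-adjacent _ _ c , λ { (Q , DQ , u∈Q , z∈Q) →
          inscribed-nonconsecutive Q (deleted-inscribed Q DQ) _ _ u∈Q z∈Q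
            (Equivalence.from (RimAdj⇔Consecutive _ _) c) }
        chord-survives : H′ u w
        chord-survives = proj₁ Q₀-maximal u w u∈ w∈ u≢w , λ { (Q , DQ , u∈Q , w∈Q) →
          let Q-maximal = proj₁ (deleted-inscribed Q DQ) in
          not-¬ DQ (trans (cong D (⊆-antisym
            (maximal-clique-unique Q Q₀ Q-maximal Q₀-maximal u w u≢w u∈Q w∈Q u∈ w∈)
            (maximal-clique-unique Q₀ Q Q₀-maximal Q-maximal u w u≢w u∈ w∈ u∈Q w∈Q))) Q₀-kept) }
        i₀ = proj₁ (injective⇒surjective g g-inj u)
        g-i₀ = proj₂ (injective⇒surjective g g-inj u)
        OnHoleNextTo-u : Fin (suc L) → Set
        OnHoleNextTo-u z = ∃ λ j → g j ≡ z × (j ≡ next i₀ ⊎ j ≡ prev i₀)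
        neighbour : ∀ {z} → H′ u z → OnHoleNextTo-u z
        neighbour {z} uz with injective⇒surjective g g-inj z
        ... | j , g-j = j , g-j ,
          CycleGraph-neighbours i₀ j (Equivalence.to (g-induced i₀ j) (subst₂ H′ (sym g-i₀) (sym g-j) uz))
        two-neighbours-at-most : ∀ {z₁ z₂ z₃} → OnHoleNextTo-u z₁ → OnHoleNextTo-u z₂ → OnHoleNextTo-u z₃ →
                                 z₁ ≢ z₂ → z₁ ≢ z₃ → z₂ ≢ z₃ → ⊥
        two-neighbours-at-most (j₁ , g₁ , c₁) (j₂ , g₂ , c₂) (j₃ , g₃ , c₃) z₁≢z₂ z₁≢z₃ z₂≢z₃
          with three-in-two c₁ c₂ c₃
        ... | inj₁ j₁≡j₂        = z₁≢z₂ (trans (sym g₁) (trans (cong g j₁≡j₂) g₂))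
        ... | inj₂ (inj₁ j₁≡j₃) = z₁≢z₃ (trans (sym g₁) (trans (cong g j₁≡j₃) g₃))
        ... | inj₂ (inj₂ j₂≡j₃) = z₂≢z₃ (trans (sym g₂) (trans (cong g j₂≡j₃) g₃))

      -- A shorter hole of H′ is a shorter odd cycle of A: a row through two consecutive
      -- vertices of the hole cannot contain a third one, which would be adjacent to both in H′.
      no-odd-hole : ¬ HasOddHole H′
      no-odd-hole (suc L′ , s≤s 3≤L′ , odd′ , g , g-inj , g-induced) with m≤n⇒m<n∨m≡n (injective⇒≤ g-inj)
      ... | inj₂ L′+1≡L+1 = no-spanning-hole (suc-injective L′+1≡L+1) g g-inj g-induced
      ... | inj₁ L′<L = shortest (≤-pred L′<L) (≤-trans (s≤s (s≤s z≤n)) 3≤L′) odd′ record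
        { column = column ∘ g ; column-injective = g-inj ∘ column-injective ; link = link′ ; link-only = link′-only }
        where
        hole-edge : ∀ t → H′ (g t) (g (next t))
        hole-edge t = Equivalence.from (g-induced t (next t)) (CycleGraph-next t)
        link′ : ∀ t → ∃ λ R → A R (column (g t)) ≡ true × A R (column (g (next t))) ≡ true
        link′ t = proj₂ (proj₁ (hole-edge t))
        link′-only : ∀ t s R → A R (column (g t)) ≡ true → A R (column (g (next t))) ≡ true →
                     A R (column (g s)) ≡ true → s ≡ t ⊎ s ≡ next t
        link′-only t s R Rt Rt+1 Rs with s ≟ t | s ≟ next t
        ... | yes s≡t | _         = inj₁ s≡t
        ... | no _    | yes s≡t+1 = inj₂ s≡t+1
        ... | no s≢t  | no s≢t+1  = ⊥-elim (CycleGraph-triangle-free t s 3≤L′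
                (Equivalence.to (g-induced s t)
                  (survives-along-row (g t) (g (next t)) (g s) R t+1≢s t≢s Rt Rt+1 Rs (hole-edge t)))
                (Equivalence.to (g-induced s (next t))
                  (survives-along-row (g (next t)) (g t) (g s) R t≢s t+1≢s Rt+1 Rt Rs
                    (H′-sym _ _ (hole-edge t)))))
          where
          t≢s : g t ≢ g s
          t≢s = s≢t ∘ sym ∘ g-inj
          t+1≢s : g (next t) ≢ g s
          t+1≢s = s≢t+1 ∘ sym ∘ g-inj

    H⊆G : InducedSub H G
    H⊆G = column , column-injective , λ a b → mk⇔ id id

    induced-in-G : ∀ {k} {K : Graph k} → InducedSub K H → InducedSub K G
    induced-in-G (f , f-inj , f-induced) = column ∘ f , f-inj ∘ column-injective , f-induced

    HOH-free-multisun : DiamondFree G → ¬ HasOddHole G → ContainsHOHFreeMultisun G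
    HOH-free-multisun diamond-free no-hole = suc L , H , (multisun , no-hole-H , no-sub-hole) , H⊆G
      where
      multisun : IsMultisun H
      multisun = (H-sym , λ u uu → proj₁ uu refl) , odd , s≤s 2≤L , diamond-free ∘ induced-in-G ,
                 id , id , rim-cliques , inscribed-nonconsecutive
      no-hole-H : ¬ HasOddHole H
      no-hole-H (k , 4≤k , odd-k , hole) = no-hole (k , 4≤k , odd-k , induced-in-G hole)
      no-sub-hole : ∀ D → ValidDeletion H D → ¬ HasOddHole (DeleteCliques H D)
      no-sub-hole D (deleted-inscribed , Q₀ , Q₀-inscribed , Q₀-kept) =
        SubMultisun.no-odd-hole D deleted-inscribed Q₀ Q₀-inscribed Q₀-kept

  no-odd-cycle : ¬ ContainsC3 A → DiamondFree G → ¬ HasOddHole G → ¬ ContainsHOHFreeMultisun G → ¬ HasOddCycle A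
  no-odd-cycle noC3 diamond-free no-hole no-multisun (L , 2≤L , odd , cycle) = <-rec Claim by-length L 2≤L odd cycle
    where
    Claim : ℕ → Set
    Claim L = 2 ≤ L → Odd (suc L) → ¬ ColumnCycle A L
    by-length : ∀ L → (∀ {L′} → L′ < L → Claim L′) → Claim L
    by-length L shorter 2≤L odd cycle =
      no-multisun (ShortestOddCycle.HOH-free-multisun noC3 cycle 2≤L odd shorter diamond-free no-hole)

  module TwoRegular {k} (r : Fin k → Fin m) (c : Fin k → Fin n) (c-injective : Injective _≡_ _≡_ c)
    (row-count    : ∀ p → ∣ tabulate (λ q → A (r p) (c q)) ∣ ≡ 2)
    (column-count : ∀ q → ∣ tabulate (λ p → A (r p) (c q)) ∣ ≡ 2) where

    B : Fin k → Fin k → Bool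
    B p q = A (r p) (c q)

    other-column : Fin k → Fin k → Fin k
    other-column p = other (B p) (row-count p)

    other-row : Fin k → Fin k → Fin k
    other-row q = other (λ p → B p q) (column-count q)

    Closed : (Fin k → Bool) → Set
    Closed alive = ∀ p q q′ → B p q ≡ true → B p q′ ≡ true → alive q ≡ true → alive q′ ≡ true

    module Walk (q₀ : Fin k) where

      state : ℕ → Fin k × Fin k
      state zero    = proj₁ (some-true (λ p → B p q₀) (column-count q₀)) , q₀
      state (suc t) = let (p , q) = state t ; p′ = other-row q p in p′ , other-column p′ q

      row col : ℕ → Fin k
      row = proj₁ ∘ state
      col = proj₂ ∘ state

      row-col : ∀ t → B (row t) (col t) ≡ true
      next-row-col : ∀ t → B (row (suc t)) (col t) ≡ true
      next-row-col t = proj₁ (other-spec (λ p → B p (col t)) (column-count (col t)) (row t) (row-col t))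
      row-col zero    = proj₂ (some-true (λ p → B p q₀) (column-count q₀))
      row-col (suc t) = proj₁ (other-spec (B (row (suc t))) (row-count (row (suc t))) (col t) (next-row-col t))

      rows-of-col : ∀ t p → B p (col t) ≡ true → p ≡ row t ⊎ p ≡ row (suc t)
      rows-of-col t = proj₂ (proj₂ (other-spec (λ p → B p (col t)) (column-count (col t)) (row t) (row-col t)))

      cols-of-next-row : ∀ t q → B (row (suc t)) q ≡ true → q ≡ col t ⊎ q ≡ col (suc t)
      cols-of-next-row t = proj₂ (proj₂ (other-spec (B (row (suc t))) (row-count (row (suc t))) (col t) (next-row-col t)))

      col-moves : ∀ t → col (suc t) ≢ col t
      col-moves t = proj₁ (proj₂ (other-spec (B (row (suc t))) (row-count (row (suc t))) (col t) (next-row-col t)))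

      row-moves : ∀ t → row (suc t) ≢ row t
      row-moves t = proj₁ (proj₂ (other-spec (λ p → B p (col t)) (column-count (col t)) (row t) (row-col t)))

      repeats : ℕ → Bool
      repeats j = occursᵇ j col (col j)

      repeats-at : ∀ i j → i < j → col i ≡ col j → repeats j ≡ true
      repeats-at i j i<j e = subst (λ z → occursᵇ j col z ≡ true) e (occursᵇ⁺ j col i i<j)

      some-repeat : ∃ λ j → repeats j ≡ true
      some-repeat with pigeonhole (n<1+n k) (λ (t : Fin (suc k)) → col (toℕ t))
      ... | i , j , i<j , e = toℕ j , repeats-at (toℕ i) (toℕ j) i<j e

      first-repeat = least-true repeats (proj₁ some-repeat) (proj₂ some-repeat)

      J : ℕ
      J = proj₁ first-repeat

      InjectiveBelow : ℕ → Set
      InjectiveBelow j = ∀ a b → a < j → b < j → col a ≡ col b → a ≡ b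

      col-injective-below-J : InjectiveBelow J
      col-injective-below-J a b a<J b<J e with <-cmp a b
      ... | tri< a<b _ _ = ⊥-elim (not-¬ (repeats-at a b a<b e) (proj₂ (proj₂ first-repeat) b b<J))
      ... | tri≈ _ a≡b _ = a≡b
      ... | tri> _ _ b<a = ⊥-elim (not-¬ (repeats-at b a b<a (sym e)) (proj₂ (proj₂ first-repeat) a a<J))

      earlier-visit = occursᵇ⁻ J col (col J) (proj₁ (proj₂ first-repeat))
      i₀ = proj₁ earlier-visit
      i₀<J : i₀ < J
      i₀<J = proj₁ (proj₂ earlier-visit)

      -- Revisiting col (i + 1) at time j + 1 would put col j into row (i + 1) or row (i + 2),
      -- making it col i, col (i + 1) or col (i + 2) before time j + 1.
      first-repeat-is-start : ∀ j → InjectiveBelow j → ∀ i → i < j → col i ≡ col j → col j ≡ col 0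
      first-repeat-is-start (suc j) injective zero _ e = sym e
      first-repeat-is-start (suc j) injective (suc i) i<j e
        with rows-of-col (suc i) (row (suc j)) (subst (λ z → B (row (suc j)) z ≡ true) (sym e) (row-col (suc j)))
      ... | inj₂ same-row with cols-of-next-row (suc i) (col j) (subst (λ z → B z (col j) ≡ true) same-row (next-row-col j))
      ...   | inj₁ x = ⊥-elim (col-moves j (trans (sym e) (cong col (sym (injective j (suc i) (n<1+n j) i<j x)))))
      ...   | inj₂ x with m≤n⇒m<n∨m≡n i<j
      ...     | inj₁ i+1<j = ⊥-elim (row-moves j (trans same-row (cong row (sym (injective j (suc (suc i)) (n<1+n j) i+1<j x)))))
      ...     | inj₂ i+1≡j = ⊥-elim (col-moves j (sym (trans x (cong col i+1≡j))))
      first-repeat-is-start (suc j) injective (suc i) i<j e | inj₁ same-row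
        with cols-of-next-row i (col j) (subst (λ z → B z (col j) ≡ true) same-row (next-row-col j))
      ... | inj₁ x = ⊥-elim (<-irrefl (sym (injective j i (n<1+n j) (<-trans (n<1+n i) i<j) x)) (≤-pred i<j))
      ... | inj₂ x = ⊥-elim (col-moves j (trans (sym e) (cong col (sym (injective j (suc i) (n<1+n j) i<j x)))))

      returns-to-start : ∀ j → InjectiveBelow j → col j ≡ col 0 → 0 < j → row j ≡ row 0
      returns-to-start (suc j) injective back _
        with rows-of-col 0 (row (suc j)) (subst (λ z → B (row (suc j)) z ≡ true) back (row-col (suc j)))
      ... | inj₁ same-row = same-row
      ... | inj₂ same-row with cols-of-next-row 0 (col j) (subst (λ z → B z (col j) ≡ true) same-row (next-row-col j))
      ...   | inj₁ x = ⊥-elim (col-moves 0 (subst (λ z → col (suc z) ≡ col 0) (injective j 0 (n<1+n j) (s≤s z≤n) x) back))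
      returns-to-start (suc zero) injective back _ | inj₂ same-row | inj₂ x = ⊥-elim (col-moves 0 (sym x))
      returns-to-start (suc (suc j)) injective back _ | inj₂ same-row | inj₂ x =
        ⊥-elim (row-moves 1 (subst (λ z → row (suc z) ≡ row 1) (injective (suc j) 1 (n<1+n (suc j)) (s≤s (s≤s z≤n)) x) same-row))

      col-J≡col-0 : col J ≡ col 0
      col-J≡col-0 = first-repeat-is-start J col-injective-below-J i₀ i₀<J (proj₂ (proj₂ earlier-visit))

      row-J≡row-0 : row J ≡ row 0
      row-J≡row-0 = returns-to-start J col-injective-below-J col-J≡col-0 (≤-<-trans z≤n i₀<J)

      walk-cycle : ∀ L → J ≡ suc L → ColumnCycle A L
      walk-cycle L J≡L+1 = record
        { column = column ; column-injective = column-injective ; link = link ; link-only = link-only }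
        where
        column : Fin (suc L) → Fin n
        column i = c (col (toℕ i))
        below-J : (i : Fin (suc L)) → toℕ i < J
        below-J i = subst (toℕ i <_) (sym J≡L+1) (toℕ<n i)
        column-injective : Injective _≡_ _≡_ column
        column-injective {i} {j} = toℕ-injective ∘ col-injective-below-J _ _ (below-J i) (below-J j) ∘ c-injective
        col-next : ∀ i → col (toℕ (next i)) ≡ col (suc (toℕ i))
        col-next i with toℕ-next-cases i
        ... | inj₁ e        = cong col (sym e)
        ... | inj₂ (e₀ , e) = trans (cong col e₀) (trans (sym col-J≡col-0) (cong col (trans J≡L+1 (sym e))))
        link : ∀ i → ∃ λ R → A R (column i) ≡ true × A R (column (next i)) ≡ true
        link i = r (row (suc (toℕ i))) , next-row-col (toℕ i) ,
                 subst (λ z → B (row (suc (toℕ i))) z ≡ true) (sym (col-next i)) (row-col (suc (toℕ i)))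
        link-only : ∀ i s R → A R (column i) ≡ true → A R (column (next i)) ≡ true → A R (column s) ≡ true →
                    s ≡ i ⊎ s ≡ next i
        link-only i s R Ri Ri+1 Rs =
          Sum.map (toℕ-injective ∘ col-injective-below-J _ _ (below-J s) (below-J i))
                  (λ e → toℕ-injective (col-injective-below-J _ _ (below-J s) (below-J (next i)) (trans e (sym (col-next i)))))
                  (cols-of-next-row (toℕ i) (col (toℕ s)) (subst (λ z → A z (c (col (toℕ s))) ≡ true) R≡ Rs))
          where
          R≡ : R ≡ r (row (suc (toℕ i)))
          R≡ = row-unique Ri (subst (λ z → A R (c z) ≡ true) (col-next i) Ri+1) (next-row-col (toℕ i))
                 (row-col (suc (toℕ i))) (col-moves (toℕ i) ∘ sym ∘ c-injective)

      odd-period⇒cycle : oddᵇ J ≡ true → HasOddCycle A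
      odd-period⇒cycle = by-period J refl
        where
        by-period : ∀ j → J ≡ j → oddᵇ j ≡ true → HasOddCycle A
        by-period zero J≡0 _ = ⊥-elim (n≮0 (subst (i₀ <_) J≡0 i₀<J))
        by-period (suc zero) J≡1 _ = ⊥-elim (col-moves 0 (subst (λ z → col z ≡ col 0) J≡1 col-J≡col-0))
        by-period (suc (suc (suc L))) J≡L+1 odd = suc (suc L) , s≤s (s≤s z≤n) , oddᵇ⇒Odd _ odd , walk-cycle _ J≡L+1

      on-walk : Fin k → Bool
      on-walk = occursᵇ J col

      col-on-walk : ∀ t → t ≤ J → on-walk (col t) ≡ true
      col-on-walk t t≤J with m≤n⇒m<n∨m≡n t≤J
      ... | inj₁ t<J  = occursᵇ⁺ J col t t<J
      ... | inj₂ refl = subst (λ z → on-walk z ≡ true) (sym col-J≡col-0) (occursᵇ⁺ J col 0 (≤-<-trans z≤n i₀<J))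

      row-on-walk : ∀ p q t → t < J → B p q ≡ true → p ≡ row t ⊎ p ≡ row (suc t) → on-walk q ≡ true
      row-on-walk p q t t<J Bpq (inj₂ refl) =
        Sum.[ (λ { refl → col-on-walk t (<⇒≤ t<J) }) , (λ { refl → col-on-walk (suc t) t<J }) ] (cols-of-next-row t q Bpq)
      row-on-walk p q (suc t) t<J Bpq (inj₁ refl) =
        Sum.[ (λ { refl → col-on-walk t (<⇒≤ (<-trans (n<1+n t) t<J)) }) , (λ { refl → col-on-walk (suc t) (<⇒≤ t<J) }) ]
          (cols-of-next-row t q Bpq)
      row-on-walk p q zero t<J Bpq (inj₁ refl) = last-row J refl (subst (λ z → B z q ≡ true) (sym row-J≡row-0) Bpq)
        where
        last-row : ∀ j → J ≡ j → B (row j) q ≡ true → on-walk q ≡ true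
        last-row zero J≡0 _ = ⊥-elim (n≮0 (subst (i₀ <_) J≡0 i₀<J))
        last-row (suc j) J≡j+1 Bq =
          Sum.[ (λ { refl → col-on-walk j (subst (j ≤_) (sym J≡j+1) (n≤1+n j)) })
              , (λ { refl → col-on-walk (suc j) (subst (suc j ≤_) (sym J≡j+1) ≤-refl) }) ]
            (cols-of-next-row j q Bq)

      module Removal (alive : Fin k → Bool) (closed : Closed alive) (q₀-alive : alive q₀ ≡ true) where

        walk-alive : ∀ t → alive (col t) ≡ true
        walk-alive zero    = q₀-alive
        walk-alive (suc t) = closed (row (suc t)) (col t) (col (suc t)) (next-row-col t) (row-col (suc t)) (walk-alive t)

        alive′ : Fin k → Bool
        alive′ q = alive q ∧ not (on-walk q)

        alive′⇒alive : ∀ {q} → alive′ q ≡ true → alive q ≡ true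
        alive′⇒alive {q} e with alive q
        ... | true = refl

        alive′⇒off-walk : ∀ {q} → alive′ q ≡ true → on-walk q ≡ false
        alive′⇒off-walk {q} e with alive q | on-walk q
        ... | true | false = refl

        closed′ : Closed alive′
        closed′ p q q′ Bpq Bpq′ q-alive′ with on-walk q′ in q′-on-walk
        ... | false = cong (_∧ true) (closed p q q′ Bpq Bpq′ (alive′⇒alive q-alive′))
        ... | true with occursᵇ⁻ J col q′ q′-on-walk
        ...   | t , t<J , refl = ⊥-elim (not-¬ (row-on-walk p q t t<J Bpq (rows-of-col t p Bpq′)) (alive′⇒off-walk q-alive′))

        alive′-xor : ∀ q → alive′ q ≡ alive q xor on-walk q
        alive′-xor q with on-walk q in q-on-walk
        ... | false = trans (∧-identityʳ (alive q)) (sym (xor-identityʳ (alive q)))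
        ... | true with occursᵇ⁻ J col q q-on-walk
        ...   | t , _ , refl rewrite walk-alive t = refl

        even-period⇒same-parity : oddᵇ J ≡ false → oddSizeᵇ alive′ ≡ oddSizeᵇ alive
        even-period⇒same-parity even = begin
          oddSizeᵇ alive′                          ≡⟨ oddSizeᵇ-cong alive′ _ alive′-xor ⟩
          oddSizeᵇ (λ q → alive q xor on-walk q)   ≡⟨ oddSizeᵇ-xor alive on-walk ⟩
          oddSizeᵇ alive xor oddSizeᵇ on-walk      ≡⟨ cong (oddSizeᵇ alive xor_) (oddSizeᵇ-occurs J col col-injective-below-J) ⟩
          oddSizeᵇ alive xor oddᵇ J                ≡⟨ cong (oddSizeᵇ alive xor_) even ⟩
          oddSizeᵇ alive xor false                 ≡⟨ xor-identityʳ (oddSizeᵇ alive) ⟩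
          oddSizeᵇ alive                           ∎
          where open ≡-Reasoning

        smaller : ∣ tabulate alive′ ∣ < ∣ tabulate alive ∣
        smaller = p⊂q⇒∣p∣<∣q∣
          ( ∈-tabulate⁺ alive ∘ alive′⇒alive ∘ ∈-tabulate⁻ alive′
          , q₀ , ∈-tabulate⁺ alive q₀-alive
          , λ q₀∈ → not-¬ (occursᵇ⁺ J col 0 (≤-<-trans z≤n i₀<J)) (alive′⇒off-walk (∈-tabulate⁻ alive′ q₀∈)))

    -- The walk from an alive column is a cycle; if it is even, deleting its columns keeps the
    -- alive set closed and of odd size.
    cycle-or-smaller : ∀ alive → Closed alive → oddSizeᵇ alive ≡ true →
      HasOddCycle A ⊎ (∃ λ alive′ → Closed alive′ × oddSizeᵇ alive′ ≡ true × ∣ tabulate alive′ ∣ < ∣ tabulate alive ∣)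
    cycle-or-smaller alive closed odd with oddSizeᵇ⇒nonempty alive odd
    ... | q₀ , q₀-alive with oddᵇ (Walk.J q₀) in parity
    ...   | true  = inj₁ (Walk.odd-period⇒cycle q₀ parity)
    ...   | false = inj₂ (alive′ , closed′ , trans (even-period⇒same-parity parity) odd , smaller)
      where open Walk.Removal q₀ alive closed q₀-alive

    odd-closed⇒cycle : ∀ alive → Closed alive → oddSizeᵇ alive ≡ true → HasOddCycle A
    odd-closed⇒cycle alive = <-rec Claim by-size _ alive refl
      where
      Claim : ℕ → Set
      Claim N = ∀ alive → ∣ tabulate alive ∣ ≡ N → Closed alive → oddSizeᵇ alive ≡ true → HasOddCycle A
      by-size : ∀ N → (∀ {N′} → N′ < N → Claim N′) → Claim N
      by-size N smaller-sets alive refl closed odd with cycle-or-smaller alive closed odd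
      ... | inj₁ cycle = cycle
      ... | inj₂ (alive′ , closed′ , odd′ , shrinks) = smaller-sets shrinks alive′ refl closed′ odd′

    odd⇒cycle : Odd k → HasOddCycle A
    odd⇒cycle odd = odd-closed⇒cycle (λ _ → true) (λ _ _ _ _ _ _ → refl) (trans (oddSizeᵇ-full k) (Odd⇒oddᵇ odd))

proposition4 : ∀ {m n} (A : Matrix m n) → Linear A →
    Balanced A ⇔
      (¬ ContainsC3 A × DiamondFree (IntersectionGraph A) ×
       ¬ HasOddHole (IntersectionGraph A) ×
       ¬ ContainsHOHFreeMultisun (IntersectionGraph A))
proposition4 A linear = mk⇔ necessary sufficient
  where
  necessary : Balanced A → ¬ ContainsC3 A × DiamondFree (IntersectionGraph A) ×
              ¬ HasOddHole (IntersectionGraph A) × ¬ ContainsHOHFreeMultisun (IntersectionGraph A)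
  necessary balanced =
      (λ C3 → C3⇒¬Balanced A C3 balanced)
    , (λ diamond → C3⇒¬Balanced A (diamond⇒C3 linear diamond) balanced)
    , (λ hole → oddHole⇒¬Balanced A hole balanced)
    , (λ multisun → HOHFreeMultisun⇒¬Balanced A multisun balanced)
  sufficient : ¬ ContainsC3 A × DiamondFree (IntersectionGraph A) ×
               ¬ HasOddHole (IntersectionGraph A) × ¬ ContainsHOHFreeMultisun (IntersectionGraph A) → Balanced A
  sufficient (noC3 , diamond-free , no-hole , no-multisun) (k , odd , r , c , _ , c-injective , row-count , column-count) =
    no-odd-cycle linear noC3 diamond-free no-hole no-multisun
      (TwoRegular.odd⇒cycle linear r c c-injective row-count column-count odd)
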